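{- Let $\alpha$ be a word consisting of $m$ letters $x$ and $n$ letters $y$, where $x,y$ satisfy the relations $yx=w(1,1)xy+1$, $x\,w(s,t)=w(s+1,t)\,x$, $y\,w(s,t)=w(s,t+1)\,y$ for all $s,t\in\mathbb{N}$. Then in this algebra \[ \alpha=\sum_{k=0}^{\min(m,n)} r_k(w;B_\alpha)\,x^{m-k}y^{n-k}. \]
   Context: $(w(s,t))_{s,t\in\mathbb{N}}$ are indeterminates; the algebra is the unital associative algebra generated by $x,y$ and the $w(s,t)$, the $w(s,t)$ commuting among themselves, subject to the three relations above. The Ferrers board $B_\alpha$ outlined by $\alpha$ is the set of cells $(i,j)$ (column $i$, row $j$) with $1\le i\le m$ and $1\le j\le h_i$, where $h_i$ is the number of $y$'s preceding the $i$-th $x$ in $\alpha$ (reading left to right). A placement of $k$ nonattacking rooks in a board $B$ is a $k$-subset of $B$ with no two cells in the same row or column; $\mathcal{N}_k(B)$ is the set of these. A rook cancels all cells to its right in the same row and all cells below it in the same column; $U_B(P)$ is the set of cells of $B\setminus P$ not cancelled by any rook of $P$. For a cell $(i,j)$, $r_{P,(i,j)}$ is the number of rooks of $P$ in the north-west region of $(i,j)$, i.e. at cells $(i',j')$ with $i'<i$ and $j'>j$. The weighted rook number is $r_k(w;B)=\sum_{P\in\mathcal{N}_k(B)}\prod_{(s,t)\in U_B(P)}w(s-r_{P,(s,t)},t)$. -}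

module Defs where

open import Data.Nat using (ℕ; zero; suc; _∸_; _≡ᵇ_; _<ᵇ_)
open import Data.Bool using (Bool; true; false; _∧_; _∨_; not)
open import Data.List using (List; []; _∷_; _++_; map; length; applyUpTo)
open import Data.Bool.ListAction using (all; any)
open import Data.Product using (_×_; _,_; proj₁; proj₂)
open import Algebra.Bundles using (Ring)

data Letter : Set where
  X Y : Letter

countX : List Letter → ℕ
countX [] = 0
countX (X ∷ α) = suc (countX α)
countX (Y ∷ α) = countX α

countY : List Letter → ℕ
countY [] = 0
countY (X ∷ α) = countY α
countY (Y ∷ α) = suc (countY α)

heightsFrom : ℕ → List Letter → List ℕ
heightsFrom h [] = []
heightsFrom h (X ∷ α) = h ∷ heightsFrom h α
heightsFrom h (Y ∷ α) = heightsFrom (suc h) α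

heights : List Letter → List ℕ
heights = heightsFrom 0

-- a cell (i , j) : column i, row j (both starting at 1)
Cell : Set
Cell = ℕ × ℕ

col row : Cell → ℕ
col = proj₁
row = proj₂

columnsFrom : ℕ → List ℕ → List Cell
columnsFrom i [] = []
columnsFrom i (h ∷ hs) = applyUpTo (λ j → (i , suc j)) h ++ columnsFrom (suc i) hs

board : List Letter → List Cell
board α = columnsFrom 1 (heights α)

sublists : {A : Set} → List A → List (List A)
sublists [] = [] ∷ []
sublists (a ∷ as) = map (a ∷_) (sublists as) ++ sublists as

filterB : {A : Set} → (A → Bool) → List A → List A
filterB p [] = []
filterB p (a ∷ as) with p a
... | true = a ∷ filterB p as
... | false = filterB p as

cellEq : Cell → Cell → Bool
cellEq c d = (col c ≡ᵇ col d) ∧ (row c ≡ᵇ row d)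

nonattacking : List Cell → Bool
nonattacking [] = true
nonattacking (c ∷ cs) =
  all (λ d → not (col c ≡ᵇ col d) ∧ not (row c ≡ᵇ row d)) cs ∧ nonattacking cs

placements : ℕ → List Cell → List (List Cell)
placements k B = filterB (λ P → nonattacking P ∧ (length P ≡ᵇ k)) (sublists B)

cancels : Cell → Cell → Bool
cancels r c = ((row r ≡ᵇ row c) ∧ (col r <ᵇ col c)) ∨ ((col r ≡ᵇ col c) ∧ (row c <ᵇ row r))

uncancelled : List Cell → List Cell → List Cell
uncancelled B P = filterB (λ c → not (any (cellEq c) P) ∧ not (any (λ r → cancels r c) P)) B

nwCount : List Cell → Cell → ℕ
nwCount P c = length (filterB (λ r → (col r <ᵇ col c) ∧ (row c <ᵇ row r)) P)

module _ {c ℓ} (R : Ring c ℓ) where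
  open Ring R

  prodR : List Carrier → Carrier
  prodR [] = 1#
  prodR (a ∷ as) = a * prodR as

  sumR : List Carrier → Carrier
  sumR [] = 0#
  sumR (a ∷ as) = a + sumR as

  pow : Carrier → ℕ → Carrier
  pow a zero = 1#
  pow a (suc n) = a * pow a n

  evalWord : Carrier → Carrier → List Letter → Carrier
  evalWord x y [] = 1#
  evalWord x y (X ∷ α) = x * evalWord x y α
  evalWord x y (Y ∷ α) = y * evalWord x y α

  rookWeight : (ℕ → ℕ → Carrier) → List Cell → List Cell → Carrier
  rookWeight w B P = prodR (map (λ c → w (col c ∸ nwCount P c) (row c)) (uncancelled B P))

  rookNumber : (ℕ → ℕ → Carrier) → ℕ → List Cell → Carrier
  rookNumber w k B = sumR (map (rookWeight w B) (placements k B))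

module Submission where

-- The word is read from its last letter and both sides are compared through a sum over nonattacking
-- placements built column by column: each placement contributes the product of the weights of its
-- uncancelled cells times a terminal monomial x^g y^(n − k), where n is the number of y's, g the
-- number of empty columns and k the number of rooks.  Prepending x adds a column of height 0 on the
-- left, and x w(s,t) = w(s+1,t) x moves x past all weights to the terminal monomial.  Prepending y
-- adds a cell at the bottom of every column; y w(s,t) = w(s,t+1) y moves y to the terminal monomial,
-- where the normal ordering
--   y x^g = E g · x^g y + (E 0 + ⋯ + E (g − 1)) · x^(g − 1),   E g = w(1,1) ⋯ w(g,1),
-- obtained from y x = w(1,1) x y + 1, says that the new bottom row is either empty or carries a rook
-- in one of the g empty columns.  Grouping placements by their number k of rooks gives r_k(w; B_α).

open import Defs
open import Data.Nat using (ℕ; suc; _∸_; _⊓_)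
open import Data.List using (List; []; map; upTo)
open import Algebra.Bundles using (Ring)

module RookExpansion where

  open import Data.Nat using (ℕ; zero; suc; pred; _∸_; _⊓_; _+_; _≤_; _<_; z≤n; s≤s; _≡ᵇ_; _<ᵇ_)
  import Data.Nat.Properties as ℕₚ
  import Data.Bool.Properties as 𝔹ₚ
  import Data.List.Properties as Listₚ
  open import Data.Bool using (Bool; true; false; _∧_; _∨_; not; if_then_else_)
  open import Data.Bool.ListAction using (all; any)
  open import Data.List using (List; []; _∷_; _++_; _∷ʳ_; map; length; upTo; applyUpTo)
  open import Data.List.Relation.Unary.All as All using (All; []; _∷_)
  open import Data.List.Relation.Unary.All.Properties using (++⁺; applyUpTo⁺₂)
  open import Data.Product using (_×_; _,_)
  open import Data.Sum using (inj₁; inj₂)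
  open import Relation.Binary.PropositionalEquality as ≡ using (_≡_)
  import Algebra.Properties.CommutativeSemigroup as CommSemigroupProperties

  ≡ᵇ-refl : ∀ n → (n ≡ᵇ n) ≡ true
  ≡ᵇ-refl zero = ≡.refl
  ≡ᵇ-refl (suc n) = ≡ᵇ-refl n

  <⇒≡ᵇ≡false : ∀ {m n} → m < n → (m ≡ᵇ n) ≡ false
  <⇒≡ᵇ≡false {zero} {suc n} _ = ≡.refl
  <⇒≡ᵇ≡false {suc m} {suc n} (s≤s m<n) = <⇒≡ᵇ≡false m<n

  >⇒≡ᵇ≡false : ∀ {m n} → n < m → (m ≡ᵇ n) ≡ false
  >⇒≡ᵇ≡false {suc m} {zero} _ = ≡.refl
  >⇒≡ᵇ≡false {suc m} {suc n} (s≤s n<m) = >⇒≡ᵇ≡false n<m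

  <⇒<ᵇ≡true : ∀ {m n} → m < n → (m <ᵇ n) ≡ true
  <⇒<ᵇ≡true {zero} {suc n} _ = ≡.refl
  <⇒<ᵇ≡true {suc m} {suc n} (s≤s m<n) = <⇒<ᵇ≡true m<n

  ≥⇒<ᵇ≡false : ∀ {m n} → n ≤ m → (m <ᵇ n) ≡ false
  ≥⇒<ᵇ≡false {m} {zero} _ = ≡.refl
  ≥⇒<ᵇ≡false {suc m} {suc n} (s≤s n≤m) = ≥⇒<ᵇ≡false n≤m

  ≢ᵇ⇒<ᵇ+>ᵇ≡1 : ∀ m n → (m ≡ᵇ n) ≡ false → (if m <ᵇ n then 1 else 0) + (if n <ᵇ m then 1 else 0) ≡ 1
  ≢ᵇ⇒<ᵇ+>ᵇ≡1 zero zero ()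
  ≢ᵇ⇒<ᵇ+>ᵇ≡1 zero (suc n) _ = ≡.refl
  ≢ᵇ⇒<ᵇ+>ᵇ≡1 (suc m) zero _ = ≡.refl
  ≢ᵇ⇒<ᵇ+>ᵇ≡1 (suc m) (suc n) m≢n = ≢ᵇ⇒<ᵇ+>ᵇ≡1 m n m≢n

  ∧≡true : ∀ {a b} → a ∧ b ≡ true → (a ≡ true) × (b ≡ true)
  ∧≡true {true} {true} _ = ≡.refl , ≡.refl

  ∨≡false : ∀ {a b} → a ∨ b ≡ false → (a ≡ false) × (b ≡ false)
  ∨≡false {false} {false} _ = ≡.refl , ≡.refl

  not-∨ : ∀ a b → not (a ∨ b) ≡ not a ∧ not b
  not-∨ true b = ≡.refl
  not-∨ false b = ≡.refl

  private
    variable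
      A B : Set

  all-++ : ∀ (p : A → Bool) xs ys → all p (xs ++ ys) ≡ all p xs ∧ all p ys
  all-++ p [] ys = ≡.refl
  all-++ p (a ∷ xs) ys = ≡.trans (≡.cong (p a ∧_) (all-++ p xs ys)) (≡.sym (𝔹ₚ.∧-assoc (p a) _ _))

  any-++ : ∀ (p : A → Bool) xs ys → any p (xs ++ ys) ≡ any p xs ∨ any p ys
  any-++ p [] ys = ≡.refl
  any-++ p (a ∷ xs) ys = ≡.trans (≡.cong (p a ∨_) (any-++ p xs ys)) (≡.sym (𝔹ₚ.∨-assoc (p a) _ _))

  any≡false : ∀ (p : A → Bool) xs → All (λ a → p a ≡ false) xs → any p xs ≡ false
  any≡false p [] [] = ≡.refl
  any≡false p (a ∷ xs) (pa ∷ pxs) rewrite pa = any≡false p xs pxs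

  filterB-++ : ∀ (p : A → Bool) xs ys → filterB p (xs ++ ys) ≡ filterB p xs ++ filterB p ys
  filterB-++ p [] ys = ≡.refl
  filterB-++ p (a ∷ xs) ys with p a
  ... | true = ≡.cong (a ∷_) (filterB-++ p xs ys)
  ... | false = filterB-++ p xs ys

  countᵇ : (A → Bool) → List A → ℕ
  countᵇ p [] = 0
  countᵇ p (a ∷ as) = if p a then suc (countᵇ p as) else countᵇ p as

  length-filterB : ∀ (p : A → Bool) xs → length (filterB p xs) ≡ countᵇ p xs
  length-filterB p [] = ≡.refl
  length-filterB p (a ∷ xs) with p a
  ... | true = ≡.cong suc (length-filterB p xs)
  ... | false = length-filterB p xs

  countᵇ-++ : ∀ (p : A → Bool) xs ys → countᵇ p (xs ++ ys) ≡ countᵇ p xs + countᵇ p ys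
  countᵇ-++ p [] ys = ≡.refl
  countᵇ-++ p (a ∷ xs) ys with p a
  ... | true = ≡.cong suc (countᵇ-++ p xs ys)
  ... | false = countᵇ-++ p xs ys

  countᵇ-cong : ∀ (p q : A → Bool) xs → All (λ a → p a ≡ q a) xs → countᵇ p xs ≡ countᵇ q xs
  countᵇ-cong p q [] [] = ≡.refl
  countᵇ-cong p q (a ∷ xs) (pa≡qa ∷ eqs) rewrite pa≡qa = ≡.cong (λ n → if q a then suc n else n) (countᵇ-cong p q xs eqs)

  countᵇ≡0 : ∀ (p : A → Bool) xs → All (λ a → p a ≡ false) xs → countᵇ p xs ≡ 0
  countᵇ≡0 p [] [] = ≡.refl
  countᵇ≡0 p (a ∷ xs) (pa ∷ pxs) rewrite pa = countᵇ≡0 p xs pxs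

  countᵇ-map : ∀ (p : B → Bool) (f : A → B) xs → countᵇ p (map f xs) ≡ countᵇ (λ a → p (f a)) xs
  countᵇ-map p f [] = ≡.refl
  countᵇ-map p f (a ∷ xs) = ≡.cong (λ n → if p (f a) then suc n else n) (countᵇ-map p f xs)

  All-sublists : ∀ {P : A → Set} xs → All P xs → All (All P) (sublists xs)
  All-sublists [] [] = [] ∷ []
  All-sublists (a ∷ xs) (pa ∷ pxs) = ++⁺ (go (sublists xs) (All-sublists xs pxs)) (All-sublists xs pxs)
    where
    go : ∀ ss → All (All _) ss → All (All _) (map (a ∷_) ss)
    go [] [] = []
    go (s ∷ ss) (ps ∷ pss) = (pa ∷ ps) ∷ go ss pss

  length-∷ʳ : ∀ (xs : List A) a → length (xs ∷ʳ a) ≡ suc (length xs)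
  length-∷ʳ xs a = ≡.trans (Listₚ.length-++ xs) (ℕₚ.+-comm (length xs) 1)

  -- Occupied rows

  occupied : ℕ → List ℕ → Bool
  occupied t = any (_≡ᵇ t)

  belowCount aboveCount : ℕ → List ℕ → ℕ
  belowCount t = countᵇ (_<ᵇ t)
  aboveCount t = countᵇ (t <ᵇ_)

  occupied-∷ʳ : ∀ t rs r → occupied t (rs ∷ʳ r) ≡ occupied t rs ∨ (r ≡ᵇ t)
  occupied-∷ʳ t rs r = ≡.trans (any-++ (_≡ᵇ t) rs (r ∷ [])) (≡.cong (occupied t rs ∨_) (𝔹ₚ.∨-identityʳ (r ≡ᵇ t)))

  belowCount-∷ʳ : ∀ t rs r → belowCount t (rs ∷ʳ r) ≡ belowCount t rs + (if r <ᵇ t then 1 else 0)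
  belowCount-∷ʳ t rs r = countᵇ-++ (_<ᵇ t) rs (r ∷ [])

  length≡below+above : ∀ t rs → occupied t rs ≡ false → length rs ≡ belowCount t rs + aboveCount t rs
  length≡below+above t [] _ = ≡.refl
  length≡below+above t (r ∷ rs) r∉ with ∨≡false {r ≡ᵇ t} r∉
  ... | r≢t , rs∌t = begin
    suc (length rs)                                    ≡⟨ ≡.cong₂ _+_ (≡.sym (≢ᵇ⇒<ᵇ+>ᵇ≡1 r t r≢t)) (length≡below+above t rs rs∌t) ⟩
    (lt + gt) + (belowCount t rs + aboveCount t rs)    ≡⟨ +-interchange lt gt (belowCount t rs) (aboveCount t rs) ⟩
    (lt + belowCount t rs) + (gt + aboveCount t rs)    ≡⟨ ≡.cong₂ _+_ (if-suc (r <ᵇ t)) (if-suc (t <ᵇ r)) ⟩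
    belowCount t (r ∷ rs) + aboveCount t (r ∷ rs)      ∎
    where
    open ≡.≡-Reasoning
    lt = if r <ᵇ t then 1 else 0
    gt = if t <ᵇ r then 1 else 0
    open CommSemigroupProperties ℕₚ.+-commutativeSemigroup using () renaming (interchange to +-interchange)
    if-suc : ∀ b {n} → (if b then 1 else 0) + n ≡ (if b then suc n else n)
    if-suc true = ≡.refl
    if-suc false = ≡.refl

  freeRows : ℕ → List ℕ → ℕ
  freeRows zero rs = 0
  freeRows (suc n) rs = (if occupied (suc n) rs then 0 else 1) + freeRows n rs

  freeRows-[] : ∀ n → freeRows n [] ≡ n
  freeRows-[] zero = ≡.refl
  freeRows-[] (suc n) = ≡.cong suc (freeRows-[] n)

  freeRows-∷ʳ-> : ∀ n rs t → n < t → freeRows n (rs ∷ʳ t) ≡ freeRows n rs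
  freeRows-∷ʳ-> zero rs t _ = ≡.refl
  freeRows-∷ʳ-> (suc n) rs t n<t
    rewrite occupied-∷ʳ (suc n) rs t | >⇒≡ᵇ≡false n<t | 𝔹ₚ.∨-identityʳ (occupied (suc n) rs)
    = ≡.cong ((if occupied (suc n) rs then 0 else 1) +_) (freeRows-∷ʳ-> n rs t (ℕₚ.<-trans (ℕₚ.n<1+n n) n<t))

  freeRows-∷ʳ-free : ∀ n rs j → j < n → occupied (suc j) rs ≡ false → suc (freeRows n (rs ∷ʳ suc j)) ≡ freeRows n rs
  freeRows-∷ʳ-free (suc n) rs j (s≤s j≤n) j∉ with ℕₚ.m≤n⇒m<n∨m≡n j≤n
  ... | inj₂ ≡.refl rewrite occupied-∷ʳ (suc j) rs (suc j) | ≡ᵇ-refl j | 𝔹ₚ.∨-zeroʳ (occupied (suc j) rs) | j∉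
    = ≡.cong suc (freeRows-∷ʳ-> j rs (suc j) (ℕₚ.n<1+n j))
  ... | inj₁ j<n rewrite occupied-∷ʳ (suc n) rs (suc j) | <⇒≡ᵇ≡false (s≤s j<n) | 𝔹ₚ.∨-identityʳ (occupied (suc n) rs)
    with occupied (suc n) rs
  ...   | true = freeRows-∷ʳ-free n rs j j<n j∉
  ...   | false = ≡.cong suc (freeRows-∷ʳ-free n rs j j<n j∉)

  RowsWithin : ℕ → List ℕ → List ℕ → Set
  RowsWithin n rs hs = (length rs + freeRows n rs ≡ n) × All (_≤ n) hs

  RowsWithin-skip : ∀ {n rs h hs} → RowsWithin n rs (h ∷ hs) → RowsWithin n rs hs
  RowsWithin-skip (e , (_ ∷ h≤n)) = e , h≤n

  RowsWithin-take : ∀ {n rs h hs j} → RowsWithin n rs (h ∷ hs) → j < h → occupied (suc j) rs ≡ false →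
    RowsWithin n (rs ∷ʳ suc j) hs
  RowsWithin-take {n} {rs} {j = j} (e , (h≤n ∷ hs≤n)) j<h j∉ = e′ , hs≤n
    where
    open ≡.≡-Reasoning
    e′ : length (rs ∷ʳ suc j) + freeRows n (rs ∷ʳ suc j) ≡ n
    e′ = begin
      length (rs ∷ʳ suc j) + freeRows n (rs ∷ʳ suc j)   ≡⟨ ≡.cong (_+ freeRows n (rs ∷ʳ suc j)) (length-∷ʳ rs (suc j)) ⟩
      suc (length rs) + freeRows n (rs ∷ʳ suc j)        ≡⟨ ≡.sym (ℕₚ.+-suc (length rs) _) ⟩
      length rs + suc (freeRows n (rs ∷ʳ suc j))        ≡⟨ ≡.cong (length rs +_) (freeRows-∷ʳ-free n rs j (ℕₚ.<-≤-trans j<h h≤n) j∉) ⟩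
      length rs + freeRows n rs                         ≡⟨ e ⟩
      n                                                 ∎

  RowsWithin⇒length≤ : ∀ {n rs} → RowsWithin n rs [] → length rs ≤ n
  RowsWithin⇒length≤ {rs = rs} (e , _) = ≡.subst (length rs ≤_) e (ℕₚ.m≤m+n _ _)

  length-heightsFrom : ∀ h α → length (heightsFrom h α) ≡ countX α
  length-heightsFrom h [] = ≡.refl
  length-heightsFrom h (X ∷ α) = ≡.cong suc (length-heightsFrom h α)
  length-heightsFrom h (Y ∷ α) = length-heightsFrom (suc h) α

  heightsFrom-suc : ∀ h α → heightsFrom (suc h) α ≡ map suc (heightsFrom h α)
  heightsFrom-suc h [] = ≡.refl
  heightsFrom-suc h (X ∷ α) = ≡.cong (suc h ∷_) (heightsFrom-suc h α)
  heightsFrom-suc h (Y ∷ α) = heightsFrom-suc (suc h) α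

  heightsFrom≤ : ∀ h α → All (_≤ h + countY α) (heightsFrom h α)
  heightsFrom≤ h [] = []
  heightsFrom≤ h (X ∷ α) = ℕₚ.m≤m+n h _ ∷ heightsFrom≤ h α
  heightsFrom≤ h (Y ∷ α) = ≡.subst (λ n → All (_≤ n) (heightsFrom (suc h) α)) (≡.sym (ℕₚ.+-suc h _)) (heightsFrom≤ (suc h) α)

  -- qs are the occupied rows of a board with an extra bottom row, rs those of the board without it:
  -- row t + 2 of the former is row t + 1 of the latter.
  record LiftFree (qs rs : List ℕ) : Set where
    field
      occupied-lift : ∀ t → occupied (suc (suc t)) qs ≡ occupied (suc t) rs
      below-lift : ∀ t → belowCount (suc (suc t)) qs ≡ belowCount (suc t) rs
      length-lift : length qs ≡ length rs
      bottom-free : occupied 1 qs ≡ false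
      below-bottom : belowCount 1 qs ≡ 0

  record LiftTaken (qs rs : List ℕ) : Set where
    field
      occupied-lift : ∀ t → occupied (suc (suc t)) qs ≡ occupied (suc t) rs
      below-lift : ∀ t → belowCount (suc (suc t)) qs ≡ suc (belowCount (suc t) rs)
      length-lift : length qs ≡ suc (length rs)
      bottom-taken : occupied 1 qs ≡ true

  LiftFree-[] : LiftFree [] []
  LiftFree-[] = record
    { occupied-lift = λ _ → ≡.refl ; below-lift = λ _ → ≡.refl ; length-lift = ≡.refl ; bottom-free = ≡.refl ; below-bottom = ≡.refl }

  occupied-lift-∷ʳ : ∀ {qs rs} j → (∀ t → occupied (suc (suc t)) qs ≡ occupied (suc t) rs) →
    ∀ t → occupied (suc (suc t)) (qs ∷ʳ suc (suc j)) ≡ occupied (suc t) (rs ∷ʳ suc j)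
  occupied-lift-∷ʳ {qs} {rs} j lift t =
    ≡.trans (occupied-∷ʳ (suc (suc t)) qs _) (≡.trans (≡.cong (_∨ (j ≡ᵇ t)) (lift t)) (≡.sym (occupied-∷ʳ (suc t) rs _)))

  below-lift-∷ʳ : ∀ {qs rs} d j → (∀ t → belowCount (suc (suc t)) qs ≡ d + belowCount (suc t) rs) →
    ∀ t → belowCount (suc (suc t)) (qs ∷ʳ suc (suc j)) ≡ d + belowCount (suc t) (rs ∷ʳ suc j)
  below-lift-∷ʳ {qs} {rs} d j lift t = begin
    belowCount (suc (suc t)) (qs ∷ʳ suc (suc j))   ≡⟨ belowCount-∷ʳ (suc (suc t)) qs _ ⟩
    belowCount (suc (suc t)) qs + [j<t]            ≡⟨ ≡.cong (_+ [j<t]) (lift t) ⟩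
    d + belowCount (suc t) rs + [j<t]              ≡⟨ ℕₚ.+-assoc d _ _ ⟩
    d + (belowCount (suc t) rs + [j<t])            ≡⟨ ≡.cong (d +_) (≡.sym (belowCount-∷ʳ (suc t) rs _)) ⟩
    d + belowCount (suc t) (rs ∷ʳ suc j)           ∎
    where
    open ≡.≡-Reasoning
    [j<t] = if j <ᵇ t then 1 else 0

  length-lift-∷ʳ : ∀ {qs rs : List ℕ} d q r → length qs ≡ d + length rs → length (qs ∷ʳ q) ≡ d + length (rs ∷ʳ r)
  length-lift-∷ʳ {qs} {rs} d q r lift =
    ≡.trans (length-∷ʳ qs q) (≡.trans (≡.cong suc lift) (≡.trans (≡.sym (ℕₚ.+-suc d _)) (≡.cong (d +_) (≡.sym (length-∷ʳ rs r)))))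

  LiftFree-∷ʳ : ∀ {qs rs} j → LiftFree qs rs → LiftFree (qs ∷ʳ suc (suc j)) (rs ∷ʳ suc j)
  LiftFree-∷ʳ {qs} {rs} j L = record
    { occupied-lift = occupied-lift-∷ʳ {qs} {rs} j occupied-lift
    ; below-lift = below-lift-∷ʳ {qs} {rs} 0 j below-lift
    ; length-lift = length-lift-∷ʳ {qs} {rs} 0 (suc (suc j)) (suc j) length-lift
    ; bottom-free = ≡.trans (occupied-∷ʳ 1 qs _) (≡.cong (_∨ false) bottom-free)
    ; below-bottom = ≡.trans (belowCount-∷ʳ 1 qs _) (≡.cong (_+ 0) below-bottom)
    }
    where open LiftFree L

  LiftTaken-∷ʳ : ∀ {qs rs} j → LiftTaken qs rs → LiftTaken (qs ∷ʳ suc (suc j)) (rs ∷ʳ suc j)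
  LiftTaken-∷ʳ {qs} {rs} j L = record
    { occupied-lift = occupied-lift-∷ʳ {qs} {rs} j occupied-lift
    ; below-lift = below-lift-∷ʳ {qs} {rs} 1 j below-lift
    ; length-lift = length-lift-∷ʳ {qs} {rs} 1 (suc (suc j)) (suc j) length-lift
    ; bottom-taken = ≡.trans (occupied-∷ʳ 1 qs _) (≡.cong (_∨ false) bottom-taken)
    }
    where open LiftTaken L

  LiftFree⇒LiftTaken : ∀ {qs rs} → LiftFree qs rs → LiftTaken (qs ∷ʳ 1) rs
  LiftFree⇒LiftTaken {qs} {rs} L = record
    { occupied-lift = λ t → ≡.trans (occupied-∷ʳ (suc (suc t)) qs _) (≡.trans (𝔹ₚ.∨-identityʳ _) (occupied-lift t))
    ; below-lift = λ t → ≡.trans (belowCount-∷ʳ (suc (suc t)) qs _) (≡.trans (ℕₚ.+-comm _ 1) (≡.cong suc (below-lift t)))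
    ; length-lift = ≡.trans (length-∷ʳ qs _) (≡.cong suc length-lift)
    ; bottom-taken = ≡.trans (occupied-∷ʳ 1 qs _) (𝔹ₚ.∨-zeroʳ _)
    }
    where open LiftFree L

  <ᵇ-pred : ∀ m j → (m <ᵇ suc (suc j)) ≡ (pred m <ᵇ suc j)
  <ᵇ-pred zero j = ≡.refl
  <ᵇ-pred (suc m) j = ≡.refl

  module RingSums {c ℓ} (R : Ring c ℓ) where

    open Ring R renaming (_+_ to _⊕_; _*_ to _·_)
    open import Relation.Binary.Reasoning.Setoid setoid
    open CommSemigroupProperties +-commutativeSemigroup using (x∙yz≈y∙xz) renaming (interchange to ⊕-interchange)

    if-cong : ∀ {b b′ : Bool} {p q r s : Carrier} → b ≡ b′ → p ≈ q → r ≈ s → (if b then p else r) ≈ (if b′ then q else s)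
    if-cong {true} ≡.refl p≈q _ = p≈q
    if-cong {false} ≡.refl _ r≈s = r≈s

    if-true : ∀ {b} {p q : Carrier} → b ≡ true → (if b then p else q) ≈ p
    if-true ≡.refl = refl

    if-false : ∀ {b} {p q : Carrier} → b ≡ false → (if b then p else q) ≈ q
    if-false ≡.refl = refl

    *-if0 : ∀ (b : Bool) a {p : Carrier} → a · (if b then 0# else p) ≈ (if b then 0# else a · p)
    *-if0 true a = zeroʳ a
    *-if0 false a = refl

    commutes⇒x·yz≈y·xz : ∀ {a b} d → a · b ≈ b · a → a · (b · d) ≈ b · (a · d)
    commutes⇒x·yz≈y·xz d ab≈ba = trans (sym (*-assoc _ _ _)) (trans (*-cong ab≈ba refl) (*-assoc _ _ _))

    sumTo : (ℕ → Carrier) → ℕ → Carrier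
    sumTo f zero = 0#
    sumTo f (suc n) = f 0 ⊕ sumTo (λ j → f (suc j)) n

    prodIf : (ℕ → Bool) → (ℕ → Carrier) → ℕ → Carrier
    prodIf p f zero = 1#
    prodIf p f (suc n) = (if p 0 then f 0 else 1#) · prodIf (λ j → p (suc j)) (λ j → f (suc j)) n

    sumTo-cong : ∀ n {f g : ℕ → Carrier} → (∀ j → j < n → f j ≈ g j) → sumTo f n ≈ sumTo g n
    sumTo-cong zero f≈g = refl
    sumTo-cong (suc n) f≈g = +-cong (f≈g 0 (s≤s z≤n)) (sumTo-cong n (λ j j<n → f≈g (suc j) (s≤s j<n)))

    sumTo-+ : ∀ n (f g : ℕ → Carrier) → sumTo f n ⊕ sumTo g n ≈ sumTo (λ j → f j ⊕ g j) n
    sumTo-+ zero f g = +-identityˡ 0#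
    sumTo-+ (suc n) f g = trans (⊕-interchange (f 0) _ (g 0) _) (+-cong refl (sumTo-+ n (λ j → f (suc j)) (λ j → g (suc j))))

    sumTo-*ˡ : ∀ n a (f : ℕ → Carrier) → a · sumTo f n ≈ sumTo (λ j → a · f j) n
    sumTo-*ˡ zero a f = zeroʳ a
    sumTo-*ˡ (suc n) a f = trans (distribˡ a (f 0) _) (+-cong refl (sumTo-*ˡ n a (λ j → f (suc j))))

    sumTo-zero : ∀ n → sumTo (λ _ → 0#) n ≈ 0#
    sumTo-zero zero = refl
    sumTo-zero (suc n) = trans (+-identityˡ _) (sumTo-zero n)

    sumTo-select : ∀ n (f : ℕ → Carrier) {l} → l < n → sumTo (λ k → if l ≡ᵇ k then f k else 0#) n ≈ f l
    sumTo-select (suc n) f {zero} _ = trans (+-cong refl (sumTo-zero n)) (+-identityʳ _)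
    sumTo-select (suc n) f {suc l} (s≤s l<n) = trans (+-identityˡ _) (sumTo-select n (λ j → f (suc j)) l<n)

    prodIf-cong : ∀ n {p q : ℕ → Bool} {f g : ℕ → Carrier} → (∀ j → j < n → p j ≡ q j) →
      (∀ j → j < n → p j ≡ true → f j ≈ g j) → prodIf p f n ≈ prodIf q g n
    prodIf-cong zero p≡q f≈g = refl
    prodIf-cong (suc n) {p} {q} {f} {g} p≡q f≈g =
      *-cong head (prodIf-cong n (λ j j<n → p≡q (suc j) (s≤s j<n)) (λ j j<n → f≈g (suc j) (s≤s j<n)))
      where
      head : (if p 0 then f 0 else 1#) ≈ (if q 0 then g 0 else 1#)
      head with p 0 | q 0 | p≡q 0 (s≤s z≤n) | f≈g 0 (s≤s z≤n)
      ... | true  | .true  | ≡.refl | f0≈g0 = f0≈g0 ≡.refl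
      ... | false | .false | ≡.refl | _     = refl

    prodIf-comm : ∀ n a (p : ℕ → Bool) (f g : ℕ → Carrier) → (∀ j → a · f j ≈ g j · a) →
      a · prodIf p f n ≈ prodIf p g n · a
    prodIf-comm zero a p f g af≈ga = trans (*-identityʳ a) (sym (*-identityˡ a))
    prodIf-comm (suc n) a p f g af≈ga = begin
      a · (f₀ · F)   ≈⟨ sym (*-assoc a f₀ F) ⟩
      (a · f₀) · F   ≈⟨ *-cong head refl ⟩
      (g₀ · a) · F   ≈⟨ *-assoc g₀ a F ⟩
      g₀ · (a · F)   ≈⟨ *-cong refl (prodIf-comm n a (λ j → p (suc j)) (λ j → f (suc j)) (λ j → g (suc j)) (λ j → af≈ga (suc j))) ⟩
      g₀ · (G · a)   ≈⟨ sym (*-assoc g₀ G a) ⟩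
      (g₀ · G) · a   ∎
      where
      f₀ = if p 0 then f 0 else 1#
      g₀ = if p 0 then g 0 else 1#
      F = prodIf (λ j → p (suc j)) (λ j → f (suc j)) n
      G = prodIf (λ j → p (suc j)) (λ j → g (suc j)) n
      head : a · f₀ ≈ g₀ · a
      head with p 0
      ... | true = af≈ga 0
      ... | false = trans (*-identityʳ a) (sym (*-identityˡ a))

    Σ[_] : List A → (A → Carrier) → Carrier
    Σ[ xs ] f = sumR R (map f xs)

    sumR-++ : ∀ xs ys → sumR R (xs ++ ys) ≈ sumR R xs ⊕ sumR R ys
    sumR-++ [] ys = sym (+-identityˡ _)
    sumR-++ (a ∷ xs) ys = trans (+-cong refl (sumR-++ xs ys)) (sym (+-assoc _ _ _))

    Σ-++ : ∀ (xs ys : List A) f → Σ[ xs ++ ys ] f ≈ Σ[ xs ] f ⊕ Σ[ ys ] f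
    Σ-++ xs ys f = trans (reflexive (≡.cong (sumR R) (Listₚ.map-++ f xs ys))) (sumR-++ (map f xs) (map f ys))

    Σ-map : ∀ (xs : List A) (g : A → B) f → Σ[ map g xs ] f ≡ Σ[ xs ] (λ a → f (g a))
    Σ-map [] g f = ≡.refl
    Σ-map (a ∷ xs) g f = ≡.cong (f (g a) ⊕_) (Σ-map xs g f)

    Σ-cong : ∀ (xs : List A) {f g : A → Carrier} → (∀ a → f a ≈ g a) → Σ[ xs ] f ≈ Σ[ xs ] g
    Σ-cong [] f≈g = refl
    Σ-cong (a ∷ xs) f≈g = +-cong (f≈g a) (Σ-cong xs f≈g)

    Σ-congᴬ : ∀ {P : A → Set} (xs : List A) {f g : A → Carrier} → All P xs → (∀ a → P a → f a ≈ g a) → Σ[ xs ] f ≈ Σ[ xs ] g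
    Σ-congᴬ [] [] f≈g = refl
    Σ-congᴬ (a ∷ xs) (pa ∷ pxs) f≈g = +-cong (f≈g a pa) (Σ-congᴬ xs pxs f≈g)

    Σ-zero : ∀ (xs : List A) {f : A → Carrier} → (∀ a → f a ≈ 0#) → Σ[ xs ] f ≈ 0#
    Σ-zero [] f≈0 = refl
    Σ-zero (a ∷ xs) f≈0 = trans (+-cong (f≈0 a) (Σ-zero xs f≈0)) (+-identityˡ _)

    Σ-+ : ∀ (xs : List A) f g → Σ[ xs ] f ⊕ Σ[ xs ] g ≈ Σ[ xs ] (λ a → f a ⊕ g a)
    Σ-+ [] f g = +-identityˡ _
    Σ-+ (a ∷ xs) f g = trans (⊕-interchange (f a) _ (g a) _) (+-cong refl (Σ-+ xs f g))

    Σ-*ˡ : ∀ (xs : List A) a f → a · Σ[ xs ] f ≈ Σ[ xs ] (λ b → a · f b)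
    Σ-*ˡ [] a f = zeroʳ a
    Σ-*ˡ (b ∷ xs) a f = trans (distribˡ _ _ _) (+-cong refl (Σ-*ˡ xs a f))

    Σ-*ʳ : ∀ (xs : List A) a f → Σ[ xs ] f · a ≈ Σ[ xs ] (λ b → f b · a)
    Σ-*ʳ [] a f = zeroˡ a
    Σ-*ʳ (b ∷ xs) a f = trans (distribʳ _ _ _) (+-cong refl (Σ-*ʳ xs a f))

    Σ-swap : ∀ (xs : List A) (ys : List B) (F : A → B → Carrier) →
      Σ[ xs ] (λ a → Σ[ ys ] (F a)) ≈ Σ[ ys ] (λ b → Σ[ xs ] (λ a → F a b))
    Σ-swap [] ys F = sym (Σ-zero ys (λ _ → refl))
    Σ-swap (a ∷ xs) ys F = trans (+-cong refl (Σ-swap xs ys F)) (Σ-+ ys (F a) _)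

    Σ-filterB : ∀ (p : A → Bool) xs f → Σ[ filterB p xs ] f ≈ Σ[ xs ] (λ a → if p a then f a else 0#)
    Σ-filterB p [] f = refl
    Σ-filterB p (a ∷ xs) f with p a
    ... | true = +-cong refl (Σ-filterB p xs f)
    ... | false = trans (Σ-filterB p xs f) (sym (+-identityˡ _))

    Σ-applyUpTo : ∀ n (f : ℕ → A) (g : A → Carrier) → Σ[ applyUpTo f n ] g ≈ sumTo (λ j → g (f j)) n
    Σ-applyUpTo zero f g = refl
    Σ-applyUpTo (suc n) f g = +-cong refl (Σ-applyUpTo n (λ j → f (suc j)) g)

    prodR-++ : ∀ xs ys → prodR R (xs ++ ys) ≈ prodR R xs · prodR R ys
    prodR-++ [] ys = sym (*-identityˡ _)
    prodR-++ (a ∷ xs) ys = trans (*-cong refl (prodR-++ xs ys)) (sym (*-assoc _ _ _))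

    prodR-filterB-applyUpTo : ∀ n (f : ℕ → A) (p : A → Bool) (v : A → Carrier) →
      prodR R (map v (filterB p (applyUpTo f n))) ≈ prodIf (λ j → p (f j)) (λ j → v (f j)) n
    prodR-filterB-applyUpTo zero f p v = refl
    prodR-filterB-applyUpTo (suc n) f p v with p (f 0)
    ... | true = *-cong refl (prodR-filterB-applyUpTo n (λ j → f (suc j)) p v)
    ... | false = trans (prodR-filterB-applyUpTo n (λ j → f (suc j)) p v) (sym (*-identityˡ _))

    Σ-sublists-++ : ∀ (xs ys : List A) (F : List A → Carrier) →
      Σ[ sublists (xs ++ ys) ] F ≈ Σ[ sublists xs ] (λ s → Σ[ sublists ys ] (λ t → F (s ++ t)))
    Σ-sublists-++ [] ys F = sym (+-identityʳ _)
    Σ-sublists-++ (a ∷ xs) ys F = begin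
      Σ[ map (a ∷_) (sublists (xs ++ ys)) ++ sublists (xs ++ ys) ] F    ≈⟨ Σ-++ (map (a ∷_) (sublists (xs ++ ys))) _ F ⟩
      Σ[ map (a ∷_) (sublists (xs ++ ys)) ] F ⊕ Σ[ sublists (xs ++ ys) ] F
        ≈⟨ +-cong (reflexive (Σ-map (sublists (xs ++ ys)) (a ∷_) F)) refl ⟩
      Σ[ sublists (xs ++ ys) ] (λ s → F (a ∷ s)) ⊕ Σ[ sublists (xs ++ ys) ] F
        ≈⟨ +-cong (Σ-sublists-++ xs ys (λ s → F (a ∷ s))) (Σ-sublists-++ xs ys F) ⟩
      Σ[ sublists xs ] (λ s → G (a ∷ s)) ⊕ Σ[ sublists xs ] G            ≈⟨ +-cong (reflexive (≡.sym (Σ-map (sublists xs) (a ∷_) G))) refl ⟩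
      Σ[ map (a ∷_) (sublists xs) ] G ⊕ Σ[ sublists xs ] G               ≈⟨ sym (Σ-++ (map (a ∷_) (sublists xs)) (sublists xs) G) ⟩
      Σ[ map (a ∷_) (sublists xs) ++ sublists xs ] G                     ∎
      where G = λ s → Σ[ sublists ys ] (λ t → F (s ++ t))

    Σ-sublists-atMostOne : ∀ {P : A → Set} (xs : List A) (F : List A → Carrier) → All P xs →
      (∀ a b s → P a → P b → F (a ∷ b ∷ s) ≈ 0#) →
      Σ[ sublists xs ] F ≈ F [] ⊕ Σ[ xs ] (λ a → F (a ∷ []))
    Σ-sublists-atMostOne [] F [] _ = refl
    Σ-sublists-atMostOne (a ∷ xs) F (pa ∷ pxs) F≈0 = begin
      Σ[ map (a ∷_) (sublists xs) ++ sublists xs ] F              ≈⟨ Σ-++ (map (a ∷_) (sublists xs)) (sublists xs) F ⟩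
      Σ[ map (a ∷_) (sublists xs) ] F ⊕ Σ[ sublists xs ] F        ≈⟨ +-cong (reflexive (Σ-map (sublists xs) (a ∷_) F)) refl ⟩
      Σ[ sublists xs ] (λ s → F (a ∷ s)) ⊕ Σ[ sublists xs ] F
        ≈⟨ +-cong (Σ-sublists-atMostOne xs (λ s → F (a ∷ s)) pxs (λ b b′ s pb pb′ → F≈0 a b (b′ ∷ s) pa pb))
                  (Σ-sublists-atMostOne xs F pxs F≈0) ⟩
      (F (a ∷ []) ⊕ Σ[ xs ] (λ b → F (a ∷ b ∷ []))) ⊕ (F [] ⊕ Σ[ xs ] (λ b → F (b ∷ [])))
        ≈⟨ +-cong (trans (+-cong refl (Σ-congᴬ xs pxs (λ b pb → F≈0 a b [] pa pb))) (trans (+-cong refl (Σ-zero xs (λ _ → refl))) (+-identityʳ _))) refl ⟩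
      F (a ∷ []) ⊕ (F [] ⊕ Σ[ xs ] (λ b → F (b ∷ [])))           ≈⟨ x∙yz≈y∙xz (F (a ∷ [])) (F []) _ ⟩
      F [] ⊕ (F (a ∷ []) ⊕ Σ[ xs ] (λ b → F (b ∷ [])))           ∎

  module PlacementSums {c ℓ} (R : Ring c ℓ) where

    open Ring R renaming (_+_ to _⊕_; _*_ to _·_)
    open import Relation.Binary.Reasoning.Setoid setoid
    open CommSemigroupProperties +-commutativeSemigroup using () renaming (interchange to ⊕-interchange)
    open RingSums R

    Weights : Set c
    Weights = ℕ → ℕ → Carrier

    -- placementSum ω g rs hs Φ continues a placement whose rooks occupy the rows rs and which has g empty
    -- columns so far, so the current column is 1 + g + length rs; an uncancelled cell in row t of it
    -- has (column − r_{P,cell}) = 1 + g + belowCount t rs.  In columnWeight, r is the row of the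
    -- column's rook, 0 for none.
    columnWeight : Weights → ℕ → List ℕ → ℕ → ℕ → Carrier
    columnWeight ω g rs r h = prodIf (λ j → not (occupied (suc j) rs) ∧ (r <ᵇ suc j)) (λ j → ω (suc (g + belowCount (suc j) rs)) (suc j)) h

    rookInRow : Weights → ℕ → List ℕ → ℕ → (List ℕ → Carrier) → ℕ → Carrier
    rookInRow ω g rs h rest j = if occupied (suc j) rs then 0# else columnWeight ω g rs (suc j) h · rest (rs ∷ʳ suc j)

    placementSum : Weights → ℕ → List ℕ → List ℕ → Weights → Carrier
    placementSum ω g rs [] Φ = Φ g (length rs)
    placementSum ω g rs (h ∷ hs) Φ =
      columnWeight ω g rs 0 h · placementSum ω (suc g) rs hs Φ ⊕ sumTo (rookInRow ω g rs h (λ rs′ → placementSum ω g rs′ hs Φ)) h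

    placementSum-pushˡ : ∀ a (ω ω′ : Weights) δ → (∀ s t → a · ω (suc s) (suc t) ≈ ω′ (suc (δ + s)) (suc t) · a) →
      (Φ Ψ : Weights) → (∀ g k → Ψ (δ + g) k ≈ a · Φ g k) →
      ∀ hs g rs → a · placementSum ω g rs hs Φ ≈ placementSum ω′ (δ + g) rs hs Ψ
    placementSum-pushˡ a ω ω′ δ aω≈ω′a Φ Ψ Ψ≈aΦ [] g rs = sym (Ψ≈aΦ g (length rs))
    placementSum-pushˡ a ω ω′ δ aω≈ω′a Φ Ψ Ψ≈aΦ (h ∷ hs) g rs = begin
      a · (V 0 · S (suc g) rs ⊕ sumTo F h)          ≈⟨ distribˡ a _ _ ⟩
      a · (V 0 · S (suc g) rs) ⊕ a · sumTo F h      ≈⟨ +-cong (move 0 (push hs (suc g) rs)) (trans (sumTo-*ˡ h a F) (sumTo-cong h (λ j _ → rook j))) ⟩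
      V′ 0 · S′ (δ + suc g) rs ⊕ sumTo F′ h         ≈⟨ +-cong (*-cong refl (reflexive (≡.cong (λ g′ → S′ g′ rs) (ℕₚ.+-suc δ g)))) refl ⟩
      V′ 0 · S′ (suc (δ + g)) rs ⊕ sumTo F′ h       ∎
      where
      push = placementSum-pushˡ a ω ω′ δ aω≈ω′a Φ Ψ Ψ≈aΦ
      V = λ r → columnWeight ω g rs r h
      V′ = λ r → columnWeight ω′ (δ + g) rs r h
      S = λ g′ rs′ → placementSum ω g′ rs′ hs Φ
      S′ = λ g′ rs′ → placementSum ω′ g′ rs′ hs Ψ
      F = rookInRow ω g rs h (S g)
      F′ = rookInRow ω′ (δ + g) rs h (S′ (δ + g))
      aV≈V′a : ∀ r → a · V r ≈ V′ r · a
      aV≈V′a r = prodIf-comm h a _ _ _ (λ j →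
        trans (aω≈ω′a _ j) (*-cong (reflexive (≡.cong (λ s → ω′ (suc s) (suc j)) (≡.sym (ℕₚ.+-assoc δ g _)))) refl))
      move : ∀ {p q} r → a · p ≈ q → a · (V r · p) ≈ V′ r · q
      move {p} {q} r ap≈q = begin
        a · (V r · p)    ≈⟨ sym (*-assoc _ _ _) ⟩
        (a · V r) · p    ≈⟨ *-cong (aV≈V′a r) refl ⟩
        (V′ r · a) · p   ≈⟨ *-assoc _ _ _ ⟩
        V′ r · (a · p)   ≈⟨ *-cong refl ap≈q ⟩
        V′ r · q         ∎
      rook : ∀ j → a · F j ≈ F′ j
      rook j = trans (*-if0 (occupied (suc j) rs) a) (if-cong {occupied (suc j) rs} ≡.refl refl (move (suc j) (push hs g (rs ∷ʳ suc j))))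

    placementSum-+ : ∀ ω (Φ₁ Φ₂ : Weights) hs g rs →
      placementSum ω g rs hs Φ₁ ⊕ placementSum ω g rs hs Φ₂ ≈ placementSum ω g rs hs (λ g′ k → Φ₁ g′ k ⊕ Φ₂ g′ k)
    placementSum-+ ω Φ₁ Φ₂ [] g rs = refl
    placementSum-+ ω Φ₁ Φ₂ (h ∷ hs) g rs =
      trans (⊕-interchange _ _ _ _)
            (+-cong (trans (sym (distribˡ _ _ _)) (*-cong refl (placementSum-+ ω Φ₁ Φ₂ hs (suc g) rs)))
                    (trans (sumTo-+ h _ _) (sumTo-cong h (λ j _ → rook j))))
      where
      S = λ Φ rs′ → placementSum ω g rs′ hs Φ
      rook : ∀ j → rookInRow ω g rs h (S Φ₁) j ⊕ rookInRow ω g rs h (S Φ₂) j ≈ rookInRow ω g rs h (S (λ g′ k → Φ₁ g′ k ⊕ Φ₂ g′ k)) j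
      rook j with occupied (suc j) rs
      ... | true = +-identityˡ 0#
      ... | false = trans (sym (distribˡ _ _ _)) (*-cong refl (placementSum-+ ω Φ₁ Φ₂ hs g (rs ∷ʳ suc j)))

    placementSum-congᴵ : ∀ ω (Φ₁ Φ₂ : Weights) (I : ℕ → List ℕ → List ℕ → Set) →
      (∀ {g rs h hs} → I g rs (h ∷ hs) → I (suc g) rs hs) →
      (∀ {g rs h hs j} → I g rs (h ∷ hs) → j < h → occupied (suc j) rs ≡ false → I g (rs ∷ʳ suc j) hs) →
      (∀ g rs → I g rs [] → Φ₁ g (length rs) ≈ Φ₂ g (length rs)) →
      ∀ hs g rs → I g rs hs → placementSum ω g rs hs Φ₁ ≈ placementSum ω g rs hs Φ₂
    placementSum-congᴵ ω Φ₁ Φ₂ I skip take done [] g rs i = done g rs i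
    placementSum-congᴵ ω Φ₁ Φ₂ I skip take done (h ∷ hs) g rs i =
      +-cong (*-cong refl (recurse hs (suc g) rs (skip i))) (sumTo-cong h rook)
      where
      recurse = placementSum-congᴵ ω Φ₁ Φ₂ I skip take done
      rook : ∀ j → j < h →
        rookInRow ω g rs h (λ rs′ → placementSum ω g rs′ hs Φ₁) j ≈ rookInRow ω g rs h (λ rs′ → placementSum ω g rs′ hs Φ₂) j
      rook j j<h with occupied (suc j) rs in j∈?
      ... | true = refl
      ... | false = *-cong refl (recurse hs g (rs ∷ʳ suc j) (take i j<h j∈?))

  module WordExpansion {c ℓ} (R : Ring c ℓ) where

    open Ring R renaming (_+_ to _⊕_; _*_ to _·_)
    open import Relation.Binary.Reasoning.Setoid setoid
    open RingSums R
    open PlacementSums R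

    monomial : Carrier → Carrier → ℕ → Weights
    monomial x y n g k = pow R x g · pow R y (n ∸ k)

    module _ (x y : Carrier) (w : Weights)
      (yx≈ : y · x ≈ w 1 1 · x · y ⊕ 1#)
      (xw≈ : ∀ s t → x · w (suc s) (suc t) ≈ w (suc (suc s)) (suc t) · x)
      (yw≈ : ∀ s t → y · w (suc s) (suc t) ≈ w (suc s) (suc (suc t)) · y)
      (w-comm : ∀ s t s′ t′ → w (suc s) (suc t) · w (suc s′) (suc t′) ≈ w (suc s′) (suc t′) · w (suc s) (suc t)) where

      rowProd : ℕ → ℕ → Carrier
      rowProd o zero = 1#
      rowProd o (suc a) = rowProd o a · w (suc (o + a)) 1

      E : ℕ → Carrier
      E = rowProd 0

      Esum : ℕ → ℕ → Carrier
      Esum g zero = 0#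
      Esum g (suc n) = E g ⊕ Esum (suc g) n

      rowProd-comm : ∀ o a s t → rowProd o a · w (suc s) (suc t) ≈ w (suc s) (suc t) · rowProd o a
      rowProd-comm o zero s t = trans (*-identityˡ _) (sym (*-identityʳ _))
      rowProd-comm o (suc a) s t = begin
        (rowProd o a · w₁) · W    ≈⟨ *-assoc _ _ _ ⟩
        rowProd o a · (w₁ · W)    ≈⟨ *-cong refl (w-comm (o + a) 0 s t) ⟩
        rowProd o a · (W · w₁)    ≈⟨ sym (*-assoc _ _ _) ⟩
        (rowProd o a · W) · w₁    ≈⟨ *-cong (rowProd-comm o a s t) refl ⟩
        (W · rowProd o a) · w₁    ≈⟨ *-assoc _ _ _ ⟩
        W · (rowProd o a · w₁)    ∎
        where
        w₁ = w (suc (o + a)) 1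
        W = w (suc s) (suc t)

      x-rowProd : ∀ o a → x · rowProd o a ≈ rowProd (suc o) a · x
      x-rowProd o zero = trans (*-identityʳ x) (sym (*-identityˡ x))
      x-rowProd o (suc a) = begin
        x · (rowProd o a · w (suc (o + a)) 1)                  ≈⟨ sym (*-assoc _ _ _) ⟩
        (x · rowProd o a) · w (suc (o + a)) 1                  ≈⟨ *-cong (x-rowProd o a) refl ⟩
        (rowProd (suc o) a · x) · w (suc (o + a)) 1            ≈⟨ *-assoc _ _ _ ⟩
        rowProd (suc o) a · (x · w (suc (o + a)) 1)            ≈⟨ *-cong refl (xw≈ (o + a) 0) ⟩
        rowProd (suc o) a · (w (suc (suc (o + a))) 1 · x)      ≈⟨ sym (*-assoc _ _ _) ⟩
        (rowProd (suc o) a · w (suc (suc (o + a))) 1) · x      ∎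

      w-rowProd : ∀ o a → w (suc o) 1 · rowProd (suc o) a ≈ rowProd o (suc a)
      w-rowProd o zero = trans (*-identityʳ _) (trans (sym (*-identityˡ _)) (*-cong refl (reflexive (≡.cong (λ s → w (suc s) 1) (≡.sym (ℕₚ.+-identityʳ o))))))
      w-rowProd o (suc a) = begin
        w (suc o) 1 · (rowProd (suc o) a · w (suc (suc o + a)) 1)    ≈⟨ sym (*-assoc _ _ _) ⟩
        (w (suc o) 1 · rowProd (suc o) a) · w (suc (suc o + a)) 1
          ≈⟨ *-cong (w-rowProd o a) (reflexive (≡.cong (λ s → w (suc s) 1) (≡.sym (ℕₚ.+-suc o a)))) ⟩
        rowProd o (suc a) · w (suc (o + suc a)) 1                    ∎

      w₁₁-x-E : ∀ g → w 1 1 · (x · E g) ≈ E (suc g) · x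
      w₁₁-x-E g = begin
        w 1 1 · (x · rowProd 0 g)     ≈⟨ *-cong refl (x-rowProd 0 g) ⟩
        w 1 1 · (rowProd 1 g · x)     ≈⟨ sym (*-assoc _ _ _) ⟩
        (w 1 1 · rowProd 1 g) · x     ≈⟨ *-cong (w-rowProd 0 g) refl ⟩
        E (suc g) · x                 ∎

      w₁₁-x-Esum : ∀ g n → w 1 1 · (x · Esum g n) ≈ Esum (suc g) n · x
      w₁₁-x-Esum g zero = trans (*-cong refl (zeroʳ x)) (trans (zeroʳ _) (sym (zeroˡ x)))
      w₁₁-x-Esum g (suc n) = begin
        w 1 1 · (x · (E g ⊕ Esum (suc g) n))                       ≈⟨ trans (*-cong refl (distribˡ _ _ _)) (distribˡ _ _ _) ⟩
        w 1 1 · (x · E g) ⊕ w 1 1 · (x · Esum (suc g) n)           ≈⟨ +-cong (w₁₁-x-E g) (w₁₁-x-Esum (suc g) n) ⟩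
        E (suc g) · x ⊕ Esum (suc (suc g)) n · x                   ≈⟨ sym (distribʳ _ _ _) ⟩
        Esum (suc g) (suc n) · x                                   ∎

      w₁₁-x-move : ∀ {p q r} → w 1 1 · (x · p) ≈ q · x → w 1 1 · (x · (p · r)) ≈ q · (x · r)
      w₁₁-x-move {p} {q} {r} e = begin
        w 1 1 · (x · (p · r))    ≈⟨ *-cong refl (sym (*-assoc _ _ _)) ⟩
        w 1 1 · ((x · p) · r)    ≈⟨ sym (*-assoc _ _ _) ⟩
        (w 1 1 · (x · p)) · r    ≈⟨ *-cong e refl ⟩
        (q · x) · r              ≈⟨ *-assoc _ _ _ ⟩
        q · (x · r)              ∎

      y-xᵃyᵇ : ∀ a b → y · (pow R x a · pow R y b) ≈ E a · (pow R x a · pow R y (suc b)) ⊕ Esum 0 a · (pow R x (pred a) · pow R y b)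
      y-xᵃyᵇ zero b = begin
        y · (1# · yᵇ)                         ≈⟨ trans (*-cong refl (*-identityˡ _)) (sym (trans (*-identityˡ _) (*-identityˡ _))) ⟩
        1# · (1# · (y · yᵇ))                  ≈⟨ sym (+-identityʳ _) ⟩
        1# · (1# · (y · yᵇ)) ⊕ 0#             ≈⟨ +-cong refl (sym (zeroˡ _)) ⟩
        1# · (1# · (y · yᵇ)) ⊕ 0# · (1# · yᵇ) ∎
        where yᵇ = pow R y b
      y-xᵃyᵇ (suc a) b = begin
        y · ((x · xᵃ) · yᵇ)                                               ≈⟨ trans (*-cong refl (*-assoc _ _ _)) (sym (*-assoc _ _ _)) ⟩
        (y · x) · (xᵃ · yᵇ)                                               ≈⟨ *-cong yx≈ refl ⟩
        (w 1 1 · x · y ⊕ 1#) · (xᵃ · yᵇ)                                  ≈⟨ distribʳ _ _ _ ⟩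
        (w 1 1 · x · y) · (xᵃ · yᵇ) ⊕ 1# · (xᵃ · yᵇ)                      ≈⟨ +-cong (trans (*-assoc _ _ _) (*-assoc _ _ _)) (*-identityˡ _) ⟩
        w 1 1 · (x · (y · (xᵃ · yᵇ))) ⊕ xᵃ · yᵇ                           ≈⟨ +-cong (*-cong refl (*-cong refl (y-xᵃyᵇ a b))) refl ⟩
        w 1 1 · (x · (E a · (xᵃ · yᵇ⁺¹) ⊕ Esum 0 a · (pow R x (pred a) · yᵇ))) ⊕ xᵃ · yᵇ
          ≈⟨ +-cong (trans (*-cong refl (distribˡ _ _ _)) (distribˡ _ _ _)) refl ⟩
        (w 1 1 · (x · (E a · (xᵃ · yᵇ⁺¹))) ⊕ w 1 1 · (x · (Esum 0 a · (pow R x (pred a) · yᵇ)))) ⊕ xᵃ · yᵇ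
          ≈⟨ +-cong (+-cong (trans (w₁₁-x-move (w₁₁-x-E a)) (*-cong refl (sym (*-assoc _ _ _)))) (lower a)) refl ⟩
        (E (suc a) · ((x · xᵃ) · yᵇ⁺¹) ⊕ Esum 1 a · (xᵃ · yᵇ)) ⊕ xᵃ · yᵇ   ≈⟨ +-assoc _ _ _ ⟩
        E (suc a) · ((x · xᵃ) · yᵇ⁺¹) ⊕ (Esum 1 a · (xᵃ · yᵇ) ⊕ xᵃ · yᵇ) ≈⟨ +-cong refl (trans (+-comm _ _) (+-cong (sym (*-identityˡ _)) refl)) ⟩
        E (suc a) · ((x · xᵃ) · yᵇ⁺¹) ⊕ (1# · (xᵃ · yᵇ) ⊕ Esum 1 a · (xᵃ · yᵇ)) ≈⟨ +-cong refl (sym (distribʳ _ _ _)) ⟩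
        E (suc a) · ((x · xᵃ) · yᵇ⁺¹) ⊕ Esum 0 (suc a) · (xᵃ · yᵇ)        ∎
        where
        xᵃ = pow R x a
        yᵇ = pow R y b
        yᵇ⁺¹ = pow R y (suc b)
        lower : ∀ a → w 1 1 · (x · (Esum 0 a · (pow R x (pred a) · yᵇ))) ≈ Esum 1 a · (pow R x a · yᵇ)
        lower zero = trans (*-cong refl (trans (*-cong refl (zeroˡ _)) (zeroʳ x))) (trans (zeroʳ _) (sym (zeroˡ _)))
        lower (suc a) = trans (w₁₁-x-move (w₁₁-x-Esum 0 (suc a))) (*-cong refl (sym (*-assoc _ _ _)))

      w↑ : Weights
      w↑ s t = w s (suc t)

      columnWeight-liftTaken : ∀ {qs rs} → LiftTaken qs rs → ∀ g m h → columnWeight w g qs m (suc h) ≈ columnWeight w↑ (suc g) rs (pred m) h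
      columnWeight-liftTaken L g m h =
        trans (*-cong (if-false (≡.cong (λ b → not b ∧ (m <ᵇ 1)) bottom-taken)) refl)
        (trans (*-identityˡ _)
               (prodIf-cong h (λ j _ → ≡.cong₂ (λ b b′ → not b ∧ b′) (occupied-lift j) (<ᵇ-pred m j))
                              (λ j _ _ → reflexive (≡.cong (λ s → w (suc s) (suc (suc j))) (≡.trans (≡.cong (g +_) (below-lift j)) (ℕₚ.+-suc g _))))))
        where open LiftTaken L

      columnWeight-liftFree : ∀ {qs rs} → LiftFree qs rs → ∀ g m h →
        columnWeight w g qs m (suc h) ≈ (if m ≡ᵇ 0 then w (suc g) 1 else 1#) · columnWeight w↑ g rs (pred m) h
      columnWeight-liftFree {qs} L g m h =
        *-cong (bottom m)
               (prodIf-cong h (λ j _ → ≡.cong₂ (λ b b′ → not b ∧ b′) (occupied-lift j) (<ᵇ-pred m j))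
                              (λ j _ _ → reflexive (≡.cong (λ s → w (suc (g + s)) (suc (suc j))) (below-lift j))))
        where
        open LiftFree L
        bottom : ∀ m → (if not (occupied 1 qs) ∧ (m <ᵇ 1) then w (suc (g + belowCount 1 qs)) 1 else 1#) ≈ (if m ≡ᵇ 0 then w (suc g) 1 else 1#)
        bottom zero rewrite bottom-free | below-bottom | ℕₚ.+-identityʳ g = refl
        bottom (suc m) rewrite bottom-free = refl

      shiftTerminal : Weights → Weights
      shiftTerminal Φ g k = Φ (pred g) (suc k)

      placementSum-liftTaken : ∀ Φ hs g {qs rs} → LiftTaken qs rs →
        placementSum w g qs (map suc hs) Φ ≈ placementSum w↑ (suc g) rs hs (shiftTerminal Φ)
      placementSum-liftTaken Φ [] g L = reflexive (≡.cong (Φ g) (LiftTaken.length-lift L))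
      placementSum-liftTaken Φ (h ∷ hs) g {qs} {rs} L =
        +-cong (*-cong (columnWeight-liftTaken L g 0 h) (placementSum-liftTaken Φ hs (suc g) L))
               (trans (+-cong (if-true (LiftTaken.bottom-taken L)) refl) (trans (+-identityˡ _) (sumTo-cong h (λ j _ → rook j))))
        where
        rook : ∀ j → rookInRow w g qs (suc h) (λ qs′ → placementSum w g qs′ (map suc hs) Φ) (suc j)
                   ≈ rookInRow w↑ (suc g) rs h (λ rs′ → placementSum w↑ (suc g) rs′ hs (shiftTerminal Φ)) j
        rook j = if-cong (LiftTaken.occupied-lift L j) refl
                   (*-cong (columnWeight-liftTaken L g (suc (suc j)) h) (placementSum-liftTaken Φ hs g (LiftTaken-∷ʳ j L)))

      -- The bottom row of the lifted board is either empty, with weight E g′, or holds its rook in the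
      -- (i + 1)-st empty column for some g ≤ i < g′, with weight E i.
      bottomRowTerminal : Weights → ℕ → Weights
      bottomRowTerminal Φ g g′ k = E g′ · Φ g′ k ⊕ Esum g (g′ ∸ g) · Φ (pred g′) (suc k)

      bottomRowTerminal-step : ∀ Φ g g′ k → suc g ≤ g′ →
        bottomRowTerminal Φ (suc g) g′ k ⊕ E g · shiftTerminal Φ g′ k ≈ bottomRowTerminal Φ g g′ k
      bottomRowTerminal-step Φ g (suc g′) k (s≤s g≤g′) = begin
        (P ⊕ Esum (suc g) (g′ ∸ g) · Z) ⊕ E g · Z   ≈⟨ +-assoc _ _ _ ⟩
        P ⊕ (Esum (suc g) (g′ ∸ g) · Z ⊕ E g · Z)   ≈⟨ +-cong refl (trans (+-comm _ _) (sym (distribʳ _ _ _))) ⟩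
        P ⊕ Esum g (suc (g′ ∸ g)) · Z               ≈⟨ +-cong refl (*-cong (reflexive (≡.cong (Esum g) (≡.sym (ℕₚ.+-∸-assoc 1 g≤g′)))) refl) ⟩
        P ⊕ Esum g (suc g′ ∸ g) · Z                 ∎
        where
        P = E (suc g′) · Φ (suc g′) k
        Z = Φ g′ (suc k)

      E-columnWeight-comm : ∀ e g rs m h → E e · columnWeight w↑ g rs m h ≈ columnWeight w↑ g rs m h · E e
      E-columnWeight-comm e g rs m h = prodIf-comm h (E e) _ _ _ (λ j → rowProd-comm 0 e _ _)

      -- E g is the weight of the bottom cells of the g empty columns already passed: every earlier rook
      -- lies north-west of such a cell, so the bottom cell of the j-th empty column has weight w(j, 1).
      placementSum-liftFree : ∀ Φ hs g {qs rs} → LiftFree qs rs →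
        E g · placementSum w g qs (map suc hs) Φ ≈ placementSum w↑ g rs hs (bottomRowTerminal Φ g)
      placementSum-liftFree Φ [] g {qs} {rs} L = begin
        E g · Φ g (length qs)                        ≈⟨ *-cong refl (reflexive (≡.cong (Φ g) (LiftFree.length-lift L))) ⟩
        E g · Φ g (length rs)                        ≈⟨ sym (+-identityʳ _) ⟩
        E g · Φ g (length rs) ⊕ 0#                   ≈⟨ +-cong refl (sym (trans (*-cong (reflexive (≡.cong (Esum g) (ℕₚ.n∸n≡0 g))) refl) (zeroˡ _))) ⟩
        bottomRowTerminal Φ g g (length rs)          ∎
      placementSum-liftFree Φ (h ∷ hs) g {qs} {rs} L = begin
        E g · (V · Rest ⊕ (F 0 ⊕ sumTo (λ j → F (suc j)) h))                ≈⟨ trans (distribˡ _ _ _) (+-cong refl (distribˡ _ _ _)) ⟩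
        E g · (V · Rest) ⊕ (E g · F 0 ⊕ E g · sumTo (λ j → F (suc j)) h)    ≈⟨ +-cong emptyColumn (+-cong bottomRook upperRook) ⟩
        V↑ · S↑ (bottomRowTerminal Φ (suc g)) ⊕ (V↑ · S↑ (λ g′ k → E g · shiftTerminal Φ g′ k) ⊕ sumTo G h)
          ≈⟨ sym (+-assoc _ _ _) ⟩
        (V↑ · S↑ (bottomRowTerminal Φ (suc g)) ⊕ V↑ · S↑ (λ g′ k → E g · shiftTerminal Φ g′ k)) ⊕ sumTo G h
          ≈⟨ +-cong (trans (sym (distribˡ _ _ _)) (*-cong refl (trans (placementSum-+ w↑ _ _ hs (suc g) rs) merge))) refl ⟩
        V↑ · S↑ (bottomRowTerminal Φ g) ⊕ sumTo G h                       ∎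
        where
        V = columnWeight w g qs 0 (suc h)
        V↑ = columnWeight w↑ g rs 0 h
        Rest = placementSum w (suc g) qs (map suc hs) Φ
        S↑ = placementSum w↑ (suc g) rs hs
        F = rookInRow w g qs (suc h) (λ qs′ → placementSum w g qs′ (map suc hs) Φ)
        G = rookInRow w↑ g rs h (λ rs′ → placementSum w↑ g rs′ hs (bottomRowTerminal Φ g))
        emptyColumn : E g · (V · Rest) ≈ V↑ · S↑ (bottomRowTerminal Φ (suc g))
        emptyColumn = begin
          E g · (V · Rest)                           ≈⟨ *-cong refl (*-cong (columnWeight-liftFree L g 0 h) refl) ⟩
          E g · ((w (suc g) 1 · V↑) · Rest)          ≈⟨ trans (*-cong refl (*-assoc _ _ _)) (sym (*-assoc _ _ _)) ⟩
          E (suc g) · (V↑ · Rest)                    ≈⟨ commutes⇒x·yz≈y·xz Rest (E-columnWeight-comm (suc g) g rs 0 h) ⟩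
          V↑ · (E (suc g) · Rest)                    ≈⟨ *-cong refl (placementSum-liftFree Φ hs (suc g) L) ⟩
          V↑ · S↑ (bottomRowTerminal Φ (suc g))   ∎
        bottomRook : E g · F 0 ≈ V↑ · S↑ (λ g′ k → E g · shiftTerminal Φ g′ k)
        bottomRook = begin
          E g · F 0                                             ≈⟨ *-cong refl (if-false (LiftFree.bottom-free L)) ⟩
          E g · (columnWeight w g qs 1 (suc h) · placementSum w g (qs ∷ʳ 1) (map suc hs) Φ)
            ≈⟨ *-cong refl (*-cong (trans (columnWeight-liftFree L g 1 h) (*-identityˡ _)) (placementSum-liftTaken Φ hs g (LiftFree⇒LiftTaken L))) ⟩
          E g · (V↑ · S↑ (shiftTerminal Φ))                     ≈⟨ commutes⇒x·yz≈y·xz _ (E-columnWeight-comm g g rs 0 h) ⟩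
          V↑ · (E g · S↑ (shiftTerminal Φ))
            ≈⟨ *-cong refl (placementSum-pushˡ (E g) w↑ w↑ 0 (λ s t → rowProd-comm 0 g s (suc t)) (shiftTerminal Φ) _ (λ _ _ → refl) hs (suc g) rs) ⟩
          V↑ · S↑ (λ g′ k → E g · shiftTerminal Φ g′ k)         ∎
        upperRook : E g · sumTo (λ j → F (suc j)) h ≈ sumTo G h
        upperRook = trans (sumTo-*ˡ h (E g) _) (sumTo-cong h (λ j _ → trans (*-if0 (occupied (suc (suc j)) qs) (E g))
          (if-cong (LiftFree.occupied-lift L j) refl (begin
            E g · (columnWeight w g qs (suc (suc j)) (suc h) · placementSum w g (qs ∷ʳ suc (suc j)) (map suc hs) Φ)
              ≈⟨ *-cong refl (*-cong (trans (columnWeight-liftFree L g (suc (suc j)) h) (*-identityˡ _)) refl) ⟩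
            E g · (columnWeight w↑ g rs (suc j) h · placementSum w g (qs ∷ʳ suc (suc j)) (map suc hs) Φ)
              ≈⟨ commutes⇒x·yz≈y·xz _ (E-columnWeight-comm g g rs (suc j) h) ⟩
            columnWeight w↑ g rs (suc j) h · (E g · placementSum w g (qs ∷ʳ suc (suc j)) (map suc hs) Φ)
              ≈⟨ *-cong refl (placementSum-liftFree Φ hs g (LiftFree-∷ʳ j L)) ⟩
            columnWeight w↑ g rs (suc j) h · placementSum w↑ g (rs ∷ʳ suc j) hs (bottomRowTerminal Φ g) ∎))))
        merge : S↑ (λ g′ k → bottomRowTerminal Φ (suc g) g′ k ⊕ E g · shiftTerminal Φ g′ k) ≈ S↑ (bottomRowTerminal Φ g)
        merge = placementSum-congᴵ w↑ _ _ (λ g′ _ _ → suc g ≤ g′) ℕₚ.m≤n⇒m≤1+n (λ g<g′ _ _ → g<g′)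
                  (λ g′ rs′ g<g′ → bottomRowTerminal-step Φ g g′ (length rs′) g<g′) hs (suc g) rs ℕₚ.≤-refl

      evalWord≈placementSum : ∀ α → evalWord R x y α ≈ placementSum w 0 [] (heights α) (monomial x y (countY α))
      evalWord≈placementSum [] = sym (*-identityˡ 1#)
      evalWord≈placementSum (X ∷ α) = begin
        x · evalWord R x y α                   ≈⟨ *-cong refl (evalWord≈placementSum α) ⟩
        x · placementSum w 0 [] hs Φ           ≈⟨ placementSum-pushˡ x w w 1 xw≈ Φ Φ (λ g k → *-assoc _ _ _) hs 0 [] ⟩
        placementSum w 1 [] hs Φ               ≈⟨ sym (trans (+-identityʳ _) (*-identityˡ _)) ⟩
        placementSum w 0 [] (0 ∷ hs) Φ         ∎
        where
        hs = heights α
        Φ = monomial x y (countY α)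
      evalWord≈placementSum (Y ∷ α) = begin
        y · evalWord R x y α                                        ≈⟨ *-cong refl (evalWord≈placementSum α) ⟩
        y · placementSum w 0 [] hs Φ                                ≈⟨ placementSum-pushˡ y w w↑ 0 yw≈ Φ (λ g k → y · Φ g k) (λ _ _ → refl) hs 0 [] ⟩
        placementSum w↑ 0 [] hs (λ g k → y · Φ g k)
          ≈⟨ placementSum-congᴵ w↑ _ _ (λ _ → RowsWithin n) RowsWithin-skip RowsWithin-take normalOrder hs 0 [] (freeRows-[] n , heightsFrom≤ 0 α) ⟩
        placementSum w↑ 0 [] hs (bottomRowTerminal Φ′ 0)            ≈⟨ sym (placementSum-liftFree Φ′ hs 0 LiftFree-[]) ⟩
        1# · placementSum w 0 [] (map suc hs) Φ′                    ≈⟨ *-identityˡ _ ⟩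
        placementSum w 0 [] (map suc hs) Φ′
          ≈⟨ reflexive (≡.cong (λ hs′ → placementSum w 0 [] hs′ Φ′) (≡.sym (heightsFrom-suc 0 α))) ⟩
        placementSum w 0 [] (heightsFrom 1 α) Φ′                    ∎
        where
        n = countY α
        hs = heights α
        Φ = monomial x y n
        Φ′ = monomial x y (suc n)
        normalOrder : ∀ g rs → RowsWithin n rs [] → y · Φ g (length rs) ≈ bottomRowTerminal Φ′ 0 g (length rs)
        normalOrder g rs within = trans (y-xᵃyᵇ g (n ∸ length rs))
          (+-cong (*-cong refl (*-cong refl (reflexive (≡.cong (pow R y) (≡.sym (ℕₚ.+-∸-assoc 1 (RowsWithin⇒length≤ within))))))) refl)

  -- Rook placements on a Ferrers board

  nonattacking-++ˡ : ∀ (P Q : List Cell) → nonattacking P ≡ false → nonattacking (P ++ Q) ≡ false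
  nonattacking-++ˡ (a ∷ P) Q na with all (λ d → not (col a ≡ᵇ col d) ∧ not (row a ≡ᵇ row d)) P in free
  ... | true  rewrite all-++ (λ d → not (col a ≡ᵇ col d) ∧ not (row a ≡ᵇ row d)) P Q | free | nonattacking-++ˡ P Q na = 𝔹ₚ.∧-zeroʳ _
  ... | false rewrite all-++ (λ d → not (col a ≡ᵇ col d) ∧ not (row a ≡ᵇ row d)) P Q | free = ≡.refl

  nonattacking-++ʳ : ∀ (P Q : List Cell) → nonattacking Q ≡ false → nonattacking (P ++ Q) ≡ false
  nonattacking-++ʳ [] Q na = na
  nonattacking-++ʳ (a ∷ P) Q na rewrite nonattacking-++ʳ P Q na = 𝔹ₚ.∧-zeroʳ _

  nonattacking-sameColumn : ∀ (a b : Cell) P → col a ≡ col b → nonattacking (a ∷ b ∷ P) ≡ false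
  nonattacking-sameColumn (i , _) (.i , _) P ≡.refl rewrite ≡ᵇ-refl i = ≡.refl

  nonattacking-∷ʳ : ∀ i t (P : List Cell) → All (λ r → col r < i) P → nonattacking P ≡ true →
    nonattacking (P ∷ʳ (i , t)) ≡ not (occupied t (map row P))
  nonattacking-∷ʳ i t [] _ _ = ≡.refl
  nonattacking-∷ʳ i t ((a , b) ∷ P) (a<i ∷ P<i) na with ∧≡true {all (λ d → not (a ≡ᵇ col d) ∧ not (b ≡ᵇ row d)) P} na
  ... | headFree , restFree
    rewrite all-++ (λ d → not (a ≡ᵇ col d) ∧ not (b ≡ᵇ row d)) P ((i , t) ∷ []) | headFree | <⇒≡ᵇ≡false a<i
          | nonattacking-∷ʳ i t P P<i restFree | 𝔹ₚ.∧-identityʳ (not (b ≡ᵇ t)) = ≡.sym (not-∨ (b ≡ᵇ t) _)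

  cancels-fromLeft : ∀ i t (r : Cell) → col r < i → cancels r (i , t) ≡ (row r ≡ᵇ t)
  cancels-fromLeft i t (a , b) a<i rewrite <⇒<ᵇ≡true a<i | <⇒≡ᵇ≡false a<i = ≡.trans (𝔹ₚ.∨-identityʳ _) (𝔹ₚ.∧-identityʳ _)

  cancels-fromRight : ∀ i t (r : Cell) → i < col r → cancels r (i , t) ≡ false
  cancels-fromRight i t (a , b) i<a rewrite ≥⇒<ᵇ≡false (ℕₚ.<⇒≤ i<a) | >⇒≡ᵇ≡false i<a = ≡.trans (𝔹ₚ.∨-identityʳ _) (𝔹ₚ.∧-zeroʳ _)

  cellEq-≢col : ∀ c (r : Cell) → (col c ≡ᵇ col r) ≡ false → cellEq c r ≡ false
  cellEq-≢col c r c≢r rewrite c≢r = ≡.refl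

  any-cancels : ∀ i t (P : List Cell) → All (λ r → col r < i) P → any (λ r → cancels r (i , t)) P ≡ occupied t (map row P)
  any-cancels i t [] [] = ≡.refl
  any-cancels i t (r ∷ P) (r<i ∷ P<i) = ≡.cong₂ _∨_ (cancels-fromLeft i t r r<i) (any-cancels i t P P<i)

  All-columnsFrom : ∀ {i i′} hs → i < i′ → All (λ c → i < col c) (columnsFrom i′ hs)
  All-columnsFrom [] i<i′ = []
  All-columnsFrom (h ∷ hs) i<i′ = ++⁺ (applyUpTo⁺₂ _ h (λ _ → i<i′)) (All-columnsFrom hs (ℕₚ.m<n⇒m<1+n i<i′))

  columnRook : ℕ → ℕ → List Cell
  columnRook i zero = []
  columnRook i (suc r) = (i , suc r) ∷ []

  uncancelledᵇ : List Cell → Cell → Bool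
  uncancelledᵇ P c = not (any (cellEq c) P) ∧ not (any (λ r → cancels r c) P)

  uncancelled-columnRook : ∀ i r t → uncancelledᵇ (columnRook i r) (i , suc t) ≡ (r <ᵇ suc t)
  uncancelled-columnRook i zero t = ≡.refl
  uncancelled-columnRook i (suc r) t rewrite ≡ᵇ-refl i | ≥⇒<ᵇ≡false (ℕₚ.≤-refl {i}) = trichotomy t r
    where
    trichotomy : ∀ t r → not ((t ≡ᵇ r) ∨ false) ∧ not (((r ≡ᵇ t) ∧ false ∨ (t <ᵇ r)) ∨ false) ≡ (r <ᵇ t)
    trichotomy zero zero = ≡.refl
    trichotomy zero (suc r) = ≡.refl
    trichotomy (suc t) zero = ≡.refl
    trichotomy (suc t) (suc r) = trichotomy t r

  uncancelled-column : ∀ i r t P Q → All (λ c → col c < i) P → All (λ c → i < col c) Q →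
    uncancelledᵇ (P ++ (columnRook i r ++ Q)) (i , suc t) ≡ not (occupied (suc t) (map row P)) ∧ (r <ᵇ suc t)
  uncancelled-column i r t P Q P<i i<Q
    rewrite any-++ (cellEq (i , suc t)) P (columnRook i r ++ Q) | any-++ (λ c → cancels c (i , suc t)) P (columnRook i r ++ Q)
          | any-++ (cellEq (i , suc t)) (columnRook i r) Q | any-++ (λ c → cancels c (i , suc t)) (columnRook i r) Q
          | any≡false (cellEq (i , suc t)) P (All.map (λ {c} c<i → cellEq-≢col (i , suc t) c (>⇒≡ᵇ≡false c<i)) P<i)
          | any≡false (cellEq (i , suc t)) Q (All.map (λ {c} i<c → cellEq-≢col (i , suc t) c (<⇒≡ᵇ≡false i<c)) i<Q)
          | any≡false (λ c → cancels c (i , suc t)) Q (All.map (λ {c} → cancels-fromRight i (suc t) c) i<Q)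
          | any-cancels i (suc t) P P<i
          | 𝔹ₚ.∨-identityʳ (any (cellEq (i , suc t)) (columnRook i r))
          | 𝔹ₚ.∨-identityʳ (any (λ c → cancels c (i , suc t)) (columnRook i r))
          with occupied (suc t) (map row P)
  ... | true = 𝔹ₚ.∧-zeroʳ _
  ... | false = uncancelled-columnRook i r t

  nwCount-column : ∀ i r t P Q → All (λ c → col c < i) P → All (λ c → i < col c) Q →
    nwCount (P ++ (columnRook i r ++ Q)) (i , t) ≡ aboveCount t (map row P)
  nwCount-column i r t P Q P<i i<Q = begin
    length (filterB nw (P ++ (columnRook i r ++ Q)))                  ≡⟨ length-filterB nw (P ++ (columnRook i r ++ Q)) ⟩
    countᵇ nw (P ++ (columnRook i r ++ Q))
      ≡⟨ ≡.trans (countᵇ-++ nw P _) (≡.cong (countᵇ nw P +_) (countᵇ-++ nw (columnRook i r) Q)) ⟩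
    countᵇ nw P + (countᵇ nw (columnRook i r) + countᵇ nw Q)          ≡⟨ ≡.cong₂ (λ a b → countᵇ nw P + (a + b)) (rookNotNW r) rightNotNW ⟩
    countᵇ nw P + 0                                                    ≡⟨ ℕₚ.+-identityʳ _ ⟩
    countᵇ nw P
      ≡⟨ countᵇ-cong nw (λ c → t <ᵇ row c) P (All.map (λ {c} c<i → ≡.cong (_∧ (t <ᵇ row c)) (<⇒<ᵇ≡true c<i)) P<i) ⟩
    countᵇ (λ c → t <ᵇ row c) P                                        ≡⟨ ≡.sym (countᵇ-map (t <ᵇ_) row P) ⟩
    aboveCount t (map row P)                                           ∎
    where
    open ≡.≡-Reasoning
    nw : Cell → Bool
    nw c = (col c <ᵇ i) ∧ (t <ᵇ row c)
    rookNotNW : ∀ r → countᵇ nw (columnRook i r) ≡ 0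
    rookNotNW zero = ≡.refl
    rookNotNW (suc r) rewrite ≥⇒<ᵇ≡false (ℕₚ.≤-refl {i}) = ≡.refl
    rightNotNW : countᵇ nw Q ≡ 0
    rightNotNW = countᵇ≡0 nw Q (All.map (λ {c} i<c → ≡.cong (_∧ (t <ᵇ row c)) (≥⇒<ᵇ≡false (ℕₚ.<⇒≤ i<c))) i<Q)

  column∸nwCount : ∀ i g r t P Q → All (λ c → col c < i) P → All (λ c → i < col c) Q → i ≡ suc (g + length P) →
    occupied t (map row P) ≡ false → i ∸ nwCount (P ++ (columnRook i r ++ Q)) (i , t) ≡ suc (g + belowCount t (map row P))
  column∸nwCount i g r t P Q P<i i<Q i≡ t∉ rewrite nwCount-column i r t P Q P<i i<Q | i≡ = begin
    suc (g + length P) ∸ above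
      ≡⟨ ≡.cong (λ l → suc (g + l) ∸ above) (≡.trans (≡.sym (Listₚ.length-map row P)) (length≡below+above t (map row P) t∉)) ⟩
    suc (g + (below + above)) ∸ above            ≡⟨ ≡.cong (λ l → suc l ∸ above) (≡.sym (ℕₚ.+-assoc g below above)) ⟩
    suc (g + below) + above ∸ above              ≡⟨ ℕₚ.m+n∸n≡m (suc (g + below)) above ⟩
    suc (g + below)                              ∎
    where
    open ≡.≡-Reasoning
    above = aboveCount t (map row P)
    below = belowCount t (map row P)

  module RookPlacements {c ℓ} (R : Ring c ℓ) where

    open Ring R renaming (_+_ to _⊕_; _*_ to _·_)
    open import Relation.Binary.Reasoning.Setoid setoid
    open RingSums R
    open PlacementSums R

    module _ (w : Weights) where

      Σ-rookNumbers : ∀ B (ks : List ℕ) (φ : ℕ → Carrier) →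
        Σ[ ks ] (λ k → rookNumber R w k B · φ k) ≈
        Σ[ sublists B ] (λ P → if nonattacking P then rookWeight R w B P · Σ[ ks ] (λ k → if length P ≡ᵇ k then φ k else 0#) else 0#)
      Σ-rookNumbers B ks φ = begin
        Σ[ ks ] (λ k → rookNumber R w k B · φ k)
          ≈⟨ Σ-cong ks (λ k → trans (*-cong (Σ-filterB _ (sublists B) (rookWeight R w B)) refl) (Σ-*ʳ (sublists B) (φ k) _)) ⟩
        Σ[ ks ] (λ k → Σ[ sublists B ] (λ P → (if nonattacking P ∧ (length P ≡ᵇ k) then rookWeight R w B P else 0#) · φ k))
          ≈⟨ Σ-swap ks (sublists B) _ ⟩
        Σ[ sublists B ] (λ P → Σ[ ks ] (λ k → (if nonattacking P ∧ (length P ≡ᵇ k) then rookWeight R w B P else 0#) · φ k))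
          ≈⟨ Σ-cong (sublists B) byPlacement ⟩
        Σ[ sublists B ] (λ P → if nonattacking P then rookWeight R w B P · Σ[ ks ] (λ k → if length P ≡ᵇ k then φ k else 0#) else 0#) ∎
        where
        byPlacement : ∀ P → Σ[ ks ] (λ k → (if nonattacking P ∧ (length P ≡ᵇ k) then rookWeight R w B P else 0#) · φ k)
                            ≈ (if nonattacking P then rookWeight R w B P · Σ[ ks ] (λ k → if length P ≡ᵇ k then φ k else 0#) else 0#)
        byPlacement P with nonattacking P
        ... | true = trans (Σ-cong ks (λ k → pull (length P ≡ᵇ k) k)) (sym (Σ-*ˡ ks _ _))
          where
          pull : ∀ b k → (if b then rookWeight R w B P else 0#) · φ k ≈ rookWeight R w B P · (if b then φ k else 0#)
          pull true k = refl
          pull false k = trans (zeroˡ _) (sym (zeroʳ _))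
        ... | false = Σ-zero ks (λ k → zeroˡ _)

    module _ (w : Weights) (ψ : ℕ → Carrier) where

      cellWeight : List Cell → Cell → Carrier
      cellWeight P c = w (col c ∸ nwCount P c) (row c)

      column : ℕ → ℕ → List Cell
      column i h = applyUpTo (λ j → (i , suc j)) h

      weightOn : List Cell → List Cell → Carrier
      weightOn B P = prodR R (map (cellWeight P) (filterB (uncancelledᵇ P) B))

      placementWeight : ℕ → List ℕ → List Cell → Carrier
      placementWeight i hs P = if nonattacking P then weightOn (columnsFrom i hs) P · ψ (length P) else 0#

      weightOn-++ : ∀ B B′ P → weightOn (B ++ B′) P ≈ weightOn B P · weightOn B′ P
      weightOn-++ B B′ P = trans
        (reflexive (≡.trans (≡.cong (λ U → prodR R (map (cellWeight P) U)) (filterB-++ (uncancelledᵇ P) B B′))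
                            (≡.cong (prodR R) (Listₚ.map-++ (cellWeight P) (filterB (uncancelledᵇ P) B) _))))
        (prodR-++ (map (cellWeight P) (filterB (uncancelledᵇ P) B)) _)

      weightOn-column : ∀ i g r h P Q → All (λ c → col c < i) P → All (λ c → i < col c) Q → i ≡ suc (g + length P) →
        weightOn (column i h) (P ++ (columnRook i r ++ Q)) ≈ columnWeight w g (map row P) r h
      weightOn-column i g r h P Q P<i i<Q i≡ = trans (prodR-filterB-applyUpTo h (λ j → (i , suc j)) (uncancelledᵇ P′) (cellWeight P′))
        (prodIf-cong h (λ j _ → uncancelled-column i r j P Q P<i i<Q)
          (λ j _ free → reflexive (≡.cong (λ s → w s (suc j))
            (column∸nwCount i g r (suc j) P Q P<i i<Q i≡ (rowFree (≡.trans (≡.sym (uncancelled-column i r j P Q P<i i<Q)) free))))))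
        where
        P′ = P ++ (columnRook i r ++ Q)
        rowFree : ∀ {a b} → not a ∧ b ≡ true → a ≡ false
        rowFree {false} _ = ≡.refl

      placementWeight-column : ∀ i g r h hs P Q → All (λ c → col c < i) P → All (λ c → i < col c) Q → i ≡ suc (g + length P) →
        placementWeight i (h ∷ hs) (P ++ (columnRook i r ++ Q)) ≈ columnWeight w g (map row P) r h · placementWeight (suc i) hs (P ++ (columnRook i r ++ Q))
      placementWeight-column i g r h hs P Q P<i i<Q i≡ with nonattacking (P ++ (columnRook i r ++ Q))
      ... | true = begin
        weightOn (column i h ++ columnsFrom (suc i) hs) P′ · ψ (length P′)
          ≈⟨ *-cong (weightOn-++ (column i h) (columnsFrom (suc i) hs) P′) refl ⟩
        (weightOn (column i h) P′ · weightOn (columnsFrom (suc i) hs) P′) · ψ (length P′)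
          ≈⟨ *-cong (*-cong (weightOn-column i g r h P Q P<i i<Q i≡) refl) refl ⟩
        (columnWeight w g (map row P) r h · weightOn (columnsFrom (suc i) hs) P′) · ψ (length P′)
          ≈⟨ *-assoc _ _ _ ⟩
        columnWeight w g (map row P) r h · (weightOn (columnsFrom (suc i) hs) P′ · ψ (length P′)) ∎
        where P′ = P ++ (columnRook i r ++ Q)
      ... | false = sym (zeroʳ _)

      placementsFrom : ℕ → List Cell → List ℕ → Carrier
      placementsFrom i P hs = Σ[ sublists (columnsFrom i hs) ] (λ Q → placementWeight i hs (P ++ Q))

      placementsFrom≈placementSum : ∀ hs i g P → All (λ c → col c < i) P → nonattacking P ≡ true → i ≡ suc (g + length P) →
        placementsFrom i P hs ≈ placementSum w g (map row P) hs (λ _ → ψ)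
      placementsFrom≈placementSum [] i g P P<i na i≡ =
        trans (+-identityʳ _) (trans (if-true (≡.trans (≡.cong nonattacking (Listₚ.++-identityʳ P)) na))
          (trans (*-identityˡ _) (reflexive (≡.cong ψ (≡.trans (≡.cong length (Listₚ.++-identityʳ P)) (≡.sym (Listₚ.length-map row P)))))))
      placementsFrom≈placementSum (h ∷ hs) i g P P<i na i≡ = begin
        Σ[ sublists (column i h ++ right) ] F           ≈⟨ Σ-sublists-++ (column i h) right F ⟩
        Σ[ sublists (column i h) ] G                    ≈⟨ Σ-sublists-atMostOne (column i h) G (applyUpTo⁺₂ _ h (λ _ → ≡.refl)) twoRooks ⟩
        G [] ⊕ Σ[ column i h ] (λ c → G (c ∷ []))       ≈⟨ +-cong emptyColumn (trans (Σ-applyUpTo h _ (λ c → G (c ∷ []))) (sumTo-cong h rookAt)) ⟩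
        placementSum w g rows (h ∷ hs) (λ _ → ψ)        ∎
        where
        right = columnsFrom (suc i) hs
        rows = map row P
        F = λ Q → placementWeight i (h ∷ hs) (P ++ Q)
        G = λ Q₁ → Σ[ sublists right ] (λ Q₂ → F (Q₁ ++ Q₂))
        i<right : All (All (λ c → i < col c)) (sublists right)
        i<right = All-sublists right (All-columnsFrom hs (ℕₚ.n<1+n i))
        twoRooks : ∀ a b Q → col a ≡ i → col b ≡ i → G (a ∷ b ∷ Q) ≈ 0#
        twoRooks a b Q a∈i b∈i = Σ-zero (sublists right)
          (λ Q₂ → if-false (nonattacking-++ʳ P (a ∷ b ∷ (Q ++ Q₂)) (nonattacking-sameColumn a b (Q ++ Q₂) (≡.trans a∈i (≡.sym b∈i)))))
        emptyColumn : G [] ≈ columnWeight w g rows 0 h · placementSum w (suc g) rows hs (λ _ → ψ)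
        emptyColumn = begin
          Σ[ sublists right ] F
            ≈⟨ Σ-congᴬ (sublists right) i<right (λ Q i<Q → placementWeight-column i g 0 h hs P Q P<i i<Q i≡) ⟩
          Σ[ sublists right ] (λ Q → V · placementWeight (suc i) hs (P ++ Q)) ≈⟨ sym (Σ-*ˡ (sublists right) _ _) ⟩
          V · placementsFrom (suc i) P hs
            ≈⟨ *-cong refl (placementsFrom≈placementSum hs (suc i) (suc g) P (All.map ℕₚ.m<n⇒m<1+n P<i) na (≡.cong suc i≡)) ⟩
          V · placementSum w (suc g) rows hs (λ _ → ψ)                     ∎
          where V = columnWeight w g rows 0 h
        rookAt : ∀ j → j < h → G ((i , suc j) ∷ []) ≈ rookInRow w g rows h (λ rs → placementSum w g rs hs (λ _ → ψ)) j
        rookAt j j<h with occupied (suc j) rows in occ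
        ... | true = Σ-zero (sublists right) (λ Q → if-false (≡.trans (≡.cong nonattacking (≡.sym (Listₚ.++-assoc P ((i , suc j) ∷ []) Q)))
                       (nonattacking-++ˡ (P ∷ʳ (i , suc j)) Q (≡.trans (nonattacking-∷ʳ i (suc j) P P<i na) (≡.cong not occ)))))
        ... | false = begin
          Σ[ sublists right ] (λ Q → F ((i , suc j) ∷ Q))
            ≈⟨ Σ-congᴬ (sublists right) i<right (λ Q i<Q → trans (placementWeight-column i g (suc j) h hs P Q P<i i<Q i≡)
                  (*-cong refl (reflexive (≡.cong (placementWeight (suc i) hs) (≡.sym (Listₚ.++-assoc P ((i , suc j) ∷ []) Q)))))) ⟩
          Σ[ sublists right ] (λ Q → V · placementWeight (suc i) hs (P′ ++ Q))   ≈⟨ sym (Σ-*ˡ (sublists right) _ _) ⟩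
          V · placementsFrom (suc i) P′ hs
            ≈⟨ *-cong refl (placementsFrom≈placementSum hs (suc i) g P′ P′<i na′ i≡′) ⟩
          V · placementSum w g (map row P′) hs (λ _ → ψ)
            ≈⟨ *-cong refl (reflexive (≡.cong (λ rs → placementSum w g rs hs (λ _ → ψ)) (Listₚ.map-++ row P ((i , suc j) ∷ [])))) ⟩
          V · placementSum w g (rows ∷ʳ suc j) hs (λ _ → ψ)                       ∎
          where
          V = columnWeight w g rows (suc j) h
          P′ = P ∷ʳ (i , suc j)
          P′<i : All (λ c → col c < suc i) P′
          P′<i = ++⁺ (All.map ℕₚ.m<n⇒m<1+n P<i) (ℕₚ.n<1+n i ∷ [])
          na′ : nonattacking P′ ≡ true
          na′ = ≡.trans (nonattacking-∷ʳ i (suc j) P P<i na) (≡.cong not occ)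
          i≡′ : suc i ≡ suc (g + length P′)
          i≡′ = ≡.cong suc (≡.trans i≡ (≡.trans (≡.sym (ℕₚ.+-suc g (length P))) (≡.cong (g +_) (≡.sym (length-∷ʳ P _)))))

  module Coefficients {c ℓ} (R : Ring c ℓ) where

    open Ring R renaming (_+_ to _⊕_; _*_ to _·_)
    open import Relation.Binary.Reasoning.Setoid setoid
    open RingSums R
    open PlacementSums R
    open WordExpansion R using (monomial)

    module _ (x y : Carrier) (m n : ℕ) where

      coefficient : ℕ → Carrier
      coefficient k = pow R x (m ∸ k) · pow R y (n ∸ k)

      selectCoefficient : ℕ → Carrier
      selectCoefficient l = Σ[ upTo (suc (m ⊓ n)) ] (λ k → if l ≡ᵇ k then coefficient k else 0#)

      -- A placement with k rooks on a board of m columns leaves m − k of them empty, and k ≤ n because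
      -- the rooks sit in distinct rows.
      placementSum-selectCoefficient : ∀ w hs → length hs ≡ m → All (_≤ n) hs →
        placementSum w 0 [] hs (monomial x y n) ≈ placementSum w 0 [] hs (λ _ → selectCoefficient)
      placementSum-selectCoefficient w hs length≡m hs≤n =
        placementSum-congᴵ w _ _ Counted skip take select hs 0 [] (length≡m , freeRows-[] n , hs≤n)
        where
        Counted : ℕ → List ℕ → List ℕ → Set
        Counted g rs hs = (g + length rs + length hs ≡ m) × RowsWithin n rs hs
        skip : ∀ {g rs h hs} → Counted g rs (h ∷ hs) → Counted (suc g) rs hs
        skip {g} {rs} {h} {hs} (e , within) = ≡.trans (≡.sym (ℕₚ.+-suc (g + length rs) (length hs))) e , RowsWithin-skip within
        take : ∀ {g rs h hs j} → Counted g rs (h ∷ hs) → j < h → occupied (suc j) rs ≡ false → Counted g (rs ∷ʳ suc j) hs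
        take {g} {rs} {h} {hs} {j} (e , within) j<h j∉ = count , RowsWithin-take within j<h j∉
          where
          count : g + length (rs ∷ʳ suc j) + length hs ≡ m
          count = ≡.trans (≡.cong (λ l → g + l + length hs) (length-∷ʳ rs (suc j)))
                    (≡.trans (≡.cong (_+ length hs) (ℕₚ.+-suc g _)) (≡.trans (≡.sym (ℕₚ.+-suc _ _)) e))
        select : ∀ g rs → Counted g rs [] → monomial x y n g (length rs) ≈ selectCoefficient (length rs)
        select g rs (e , within) = sym (begin
          selectCoefficient k
            ≈⟨ Σ-applyUpTo (suc (m ⊓ n)) (λ k → k) _ ⟩
          sumTo (λ k′ → if k ≡ᵇ k′ then coefficient k′ else 0#) (suc (m ⊓ n))
            ≈⟨ sumTo-select (suc (m ⊓ n)) coefficient (s≤s (ℕₚ.⊓-glb k≤m (RowsWithin⇒length≤ within))) ⟩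
          coefficient k
            ≈⟨ *-cong (reflexive (≡.cong (pow R x) m∸k≡g)) refl ⟩
          monomial x y n g k ∎)
          where
          k = length rs
          g+k≡m : g + k ≡ m
          g+k≡m = ≡.trans (≡.sym (ℕₚ.+-identityʳ _)) e
          k≤m : k ≤ m
          k≤m = ≡.subst (k ≤_) g+k≡m (ℕₚ.m≤n+m k g)
          m∸k≡g : m ∸ k ≡ g
          m∸k≡g = ≡.trans (≡.cong (_∸ k) (≡.sym g+k≡m)) (ℕₚ.m+n∸n≡m g k)

theorem4p1 : ∀ {c ℓ} (R : Ring c ℓ) → let open Ring R in
    (x y : Carrier) (w : ℕ → ℕ → Carrier) →
    y * x ≈ w 1 1 * x * y + 1# →
    (∀ s t → x * w (suc s) (suc t) ≈ w (suc (suc s)) (suc t) * x) →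
    (∀ s t → y * w (suc s) (suc t) ≈ w (suc s) (suc (suc t)) * y) →
    (∀ s t s′ t′ → w (suc s) (suc t) * w (suc s′) (suc t′) ≈ w (suc s′) (suc t′) * w (suc s) (suc t)) →
    (α : List Letter) →
    evalWord R x y α ≈
      sumR R (map (λ k → rookNumber R w k (board α) * (pow R x (countX α ∸ k) * pow R y (countY α ∸ k)))
                  (upTo (suc (countX α ⊓ countY α))))
theorem4p1 R x y w yx≈ xw≈ yw≈ w-comm α = begin
  evalWord R x y α                                ≈⟨ evalWord≈placementSum x y w yx≈ xw≈ yw≈ w-comm α ⟩
  placementSum w 0 [] hs (monomial x y n)         ≈⟨ placementSum-selectCoefficient x y m n w hs (length-heightsFrom 0 α) (heightsFrom≤ 0 α) ⟩
  placementSum w 0 [] hs (λ _ → ψ)                ≈⟨ sym (placementsFrom≈placementSum w ψ hs 1 0 [] [] ≡-refl ≡-refl) ⟩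
  placementsFrom w ψ 1 [] hs                      ≈⟨ sym (Σ-rookNumbers w (board α) (upTo (suc (m ⊓ n))) (coefficient x y m n)) ⟩
  Σ[ upTo (suc (m ⊓ n)) ] (λ k → rookNumber R w k (board α) * coefficient x y m n k) ∎
  where
  open Ring R
  open import Relation.Binary.PropositionalEquality using () renaming (refl to ≡-refl)
  open import Data.List.Relation.Unary.All using ([])
  open import Relation.Binary.Reasoning.Setoid setoid
  open RookExpansion
  open RingSums R
  open PlacementSums R
  open WordExpansion R
  open RookPlacements R
  open Coefficients R
  m = countX α
  n = countY α
  hs = heights α
  ψ = selectCoefficient x y m n
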